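{- Let $n=p^{m_1}q^{m_2}$, where $p<q$ are distinct primes and $m_1,m_2$ are positive integers. Then the characteristic polynomial of the adjacency matrix of the essential ideal graph $\mathcal{E}_{\mathbb{Z}_n}$ is $$P_{\mathcal{E}_{\mathbb{Z}_n}}(\lambda)=\lambda^{m_1+m_2-2}(\lambda+1)^{m_1m_2-2}P(\lambda),$$ where $P(\lambda)=\lambda^3+(2-m_1m_2)\lambda^2+\big[(1-m_1m_2)(m_1+m_2)-m_1m_2\big]\lambda-m_1^2m_2^2$.
   Context: $\mathbb{Z}_n$ is the ring of integers modulo $n$. An ideal $I$ of a commutative ring $R$ is essential if $I\cap J\neq\{0\}$ for every nonzero ideal $J$ of $R$. The essential ideal graph $\mathcal{E}_{\mathbb{Z}_n}$ is the simple graph whose vertex set is the set of all nonzero proper ideals of $\mathbb{Z}_n$, two distinct vertices $I,K$ being adjacent if and only if $I+K$ is an essential ideal of $\mathbb{Z}_n$. The characteristic polynomial is $P(\lambda)=\det(\lambda I-A)$ for the adjacency matrix $A$. -}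

module Defs where

open import Data.Nat as ℕ using (ℕ; zero; suc; _∸_)
open import Data.Nat.DivMod using (_mod_)
open import Data.Fin using (Fin; toℕ; punchIn) renaming (zero to fzero; suc to fsuc)
open import Data.Fin.Subset using (Subset; _∈_; _∉_)
open import Data.Integer as ℤ using (ℤ; +_; -_; _+_; _*_)
open import Data.Product using (Σ; ∃; _×_; _,_)
open import Relation.Binary.PropositionalEquality using (_≡_; _≢_)

_⊕_ : ∀ {n} → Fin n → Fin n → Fin n
_⊕_ {suc k} a b = (toℕ a ℕ.+ toℕ b) mod suc k

_⊖_ : ∀ {n} → Fin n → Fin n → Fin n
_⊖_ {suc k} a b = (toℕ a ℕ.+ (suc k ∸ toℕ b)) mod suc k

_⊗_ : ∀ {n} → Fin n → Fin n → Fin n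
_⊗_ {suc k} a b = (toℕ a ℕ.* toℕ b) mod suc k

IsIdeal : ∀ {n} → Subset n → Set
IsIdeal {n} I =
  (∃ λ (a : Fin n) → a ∈ I) ×
  (∀ (a b : Fin n) → a ∈ I → b ∈ I → (a ⊖ b) ∈ I) ×
  (∀ (r a : Fin n) → a ∈ I → (r ⊗ a) ∈ I)

NonzeroSet : ∀ {n} → Subset n → Set
NonzeroSet {n} I = ∃ λ (a : Fin n) → a ∈ I × toℕ a ≢ 0

ProperSet : ∀ {n} → Subset n → Set
ProperSet {n} I = ∃ λ (a : Fin n) → a ∉ I

IsVertex : ∀ {n} → Subset n → Set
IsVertex I = IsIdeal I × NonzeroSet I × ProperSet I

InSum : ∀ {n} → Subset n → Subset n → Fin n → Set
InSum {n} I K x = ∃ λ (a : Fin n) → ∃ λ (b : Fin n) → a ∈ I × b ∈ K × x ≡ (a ⊕ b)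

IsEssential : ∀ {n} → (Fin n → Set) → Set
IsEssential {n} S =
  ∀ (J : Subset n) → IsIdeal J → NonzeroSet J →
    ∃ λ (x : Fin n) → S x × x ∈ J × toℕ x ≢ 0

-- adjacency in the essential ideal graph (for distinct vertices)
EssAdj : ∀ {n} → Subset n → Subset n → Set
EssAdj I K = IsEssential (InSum I K)

Matrix : ℕ → Set
Matrix N = Fin N → Fin N → ℤ

sumFin : ∀ {N} → (Fin N → ℤ) → ℤ
sumFin {zero}  f = + 0
sumFin {suc N} f = f fzero + sumFin (λ i → f (fsuc i))

signFin : ∀ {N} → Fin N → ℤ
signFin fzero    = + 1
signFin (fsuc j) = - signFin j

minor : ∀ {N} → Matrix (suc N) → Fin (suc N) → Matrix N
minor M j r c = M (fsuc r) (punchIn j c)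

det : ∀ {N} → Matrix N → ℤ
det {zero}  M = + 1
det {suc N} M = sumFin (λ j → signFin j * (M fzero j * det (minor M j)))

δ : ∀ {N} → Fin N → Fin N → ℤ
δ fzero    fzero    = + 1
δ fzero    (fsuc j) = + 0
δ (fsuc i) fzero    = + 0
δ (fsuc i) (fsuc j) = δ i j

charPolyAt : ∀ {N} → Matrix N → ℤ → ℤ
charPolyAt A x = det (λ i j → x * δ i j + - A i j)

_^ᶻ_ : ℤ → ℕ → ℤ
x ^ᶻ zero  = + 1
x ^ᶻ suc k = x * (x ^ᶻ k)

Pcub : ℕ → ℕ → ℤ → ℤ
Pcub m₁ m₂ x =
  let a = + (m₁ ℕ.* m₂) ; s = + (m₁ ℕ.+ m₂) in
  x ^ᶻ 3 + (+ 2 + - a) * x ^ᶻ 2 + ((+ 1 + - a) * s + - a) * x + - (a * a)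

module Submission where

-- Every nonzero ideal of ℤ_n is the set of multiples of a divisor p^α q^β of n, and I + K is
-- essential exactly when it contains n/p and n/q, the generators of the two minimal ideals.
-- So adjacency only depends on which of n/p, n/q a vertex contains: m₁m₂ - 1 vertices contain
-- both (α < m₁, β < m₂), m₂ only n/q (α = m₁) and m₁ only n/p (β = m₂), and λI - A is a matrix
-- whose entries depend only on these types. Its determinant depends only on the number of
-- vertices of each type: two rows of the same type are peeled off by the recurrence
-- D = d (2 D′ - d D″) with d = λ + [type X], and by pigeonhole only matrices of at most three
-- pairwise distinct types remain, which are evaluated directly. The closed solution of the
-- recurrence, at the counts (m₁m₂ - 1, m₂, m₁), factors as stated.

open import Data.Nat using (ℕ; suc; _^_)
import Data.Nat as Nat
open import Data.Nat.Divisibility using (_∣_)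
open import Data.Nat.Primality using (Prime)
open import Data.Fin using (Fin)
open import Data.Fin.Subset using (Subset)
open import Data.Product using (∃)
open import Function.Definitions using (Injective)
open import Relation.Binary.PropositionalEquality using (_≡_; _≢_)
open import Relation.Nullary using (¬_)
open import Defs using (IsVertex)

module Determinant where
  open import Defs
  open import Data.Nat using (ℕ; zero; suc)
  open import Data.Fin using (Fin; punchIn; inject₁) renaming (zero to fzero; suc to fsuc)
  open import Data.Fin.Properties using (_≟_)
  open import Data.Integer using (ℤ; +_; -_; _+_; _*_)
  import Data.Integer.Properties as ℤ
  open import Data.Integer.Tactic.RingSolver using (solve-∀)
  open import Data.Empty using (⊥-elim)
  open import Data.Product using (Σ; _,_)
  open import Function using (_∘′_)
  open import Relation.Binary.PropositionalEquality
  open import Relation.Nullary using (yes; no)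

  sumFin-cong : ∀ {N} {f g : Fin N → ℤ} → (∀ i → f i ≡ g i) → sumFin f ≡ sumFin g
  sumFin-cong {zero}  eq = refl
  sumFin-cong {suc N} eq = cong₂ _+_ (eq fzero) (sumFin-cong (λ i → eq (fsuc i)))

  sumFin-distrib-+ : ∀ {N} (f g : Fin N → ℤ) → sumFin (λ i → f i + g i) ≡ sumFin f + sumFin g
  sumFin-distrib-+ {zero}  f g = refl
  sumFin-distrib-+ {suc N} f g =
    trans (cong (_+_ (f fzero + g fzero)) (sumFin-distrib-+ (λ i → f (fsuc i)) (λ i → g (fsuc i))))
          (interchange (f fzero) (g fzero) _ _)
    where
    interchange : ∀ a b c d → a + b + (c + d) ≡ a + c + (b + d)
    interchange = solve-∀

  *-distribˡ-sumFin : ∀ {N} (c : ℤ) (f : Fin N → ℤ) → c * sumFin f ≡ sumFin (λ i → c * f i)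
  *-distribˡ-sumFin {zero}  c f = ℤ.*-zeroʳ c
  *-distribˡ-sumFin {suc N} c f =
    trans (ℤ.*-distribˡ-+ c (f fzero) _) (cong (_+_ (c * f fzero)) (*-distribˡ-sumFin c (λ i → f (fsuc i))))

  sumFin-neg : ∀ {N} (f : Fin N → ℤ) → sumFin (λ i → - f i) ≡ - sumFin f
  sumFin-neg {zero}  f = refl
  sumFin-neg {suc N} f =
    trans (cong (_+_ (- f fzero)) (sumFin-neg (λ i → f (fsuc i)))) (sym (ℤ.neg-distrib-+ (f fzero) _))

  sumFin-zero : ∀ {N} (f : Fin N → ℤ) → (∀ i → f i ≡ + 0) → sumFin f ≡ + 0
  sumFin-zero {zero}  f f≡0 = refl
  sumFin-zero {suc N} f f≡0 = cong₂ _+_ (f≡0 fzero) (sumFin-zero (λ i → f (fsuc i)) (λ i → f≡0 (fsuc i)))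

  det-cong : ∀ {N} {M M′ : Matrix N} → (∀ i j → M i j ≡ M′ i j) → det M ≡ det M′
  det-cong {zero}  eq = refl
  det-cong {suc N} eq = sumFin-cong λ j →
    cong₂ (λ a d → signFin j * (a * d)) (eq fzero j) (det-cong (λ r c → eq (fsuc r) (punchIn j c)))

  signFin-inject₁ : ∀ {N} (i : Fin N) → signFin (inject₁ i) ≡ signFin i
  signFin-inject₁ fzero    = refl
  signFin-inject₁ (fsuc i) = cong -_ (signFin-inject₁ i)

  swapAt : ∀ {n} → Fin (suc n) → Fin (suc (suc n)) → Fin (suc (suc n))
  swapAt         fzero    fzero            = fsuc fzero
  swapAt         fzero    (fsuc fzero)     = fzero
  swapAt         fzero    (fsuc (fsuc k))  = fsuc (fsuc k)
  swapAt {suc n} (fsuc i) fzero            = fzero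
  swapAt {suc n} (fsuc i) (fsuc k)         = fsuc (swapAt i k)

  swapAt-involutive : ∀ {n} (i : Fin (suc n)) k → swapAt i (swapAt i k) ≡ k
  swapAt-involutive         fzero    fzero           = refl
  swapAt-involutive         fzero    (fsuc fzero)    = refl
  swapAt-involutive         fzero    (fsuc (fsuc k)) = refl
  swapAt-involutive {suc n} (fsuc i) fzero           = refl
  swapAt-involutive {suc n} (fsuc i) (fsuc k)        = cong fsuc (swapAt-involutive i k)

  swapAt-inject₁ : ∀ {n} (i : Fin (suc n)) → swapAt i (inject₁ i) ≡ fsuc i
  swapAt-inject₁         fzero    = refl
  swapAt-inject₁ {suc n} (fsuc i) = cong fsuc (swapAt-inject₁ i)

  swapAt-suc : ∀ {n} (i : Fin (suc n)) → swapAt i (fsuc i) ≡ inject₁ i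
  swapAt-suc         fzero    = refl
  swapAt-suc {suc n} (fsuc i) = cong fsuc (swapAt-suc i)

  swapAt-fixes : ∀ {n} (i : Fin (suc n)) k → k ≢ inject₁ i → k ≢ fsuc i → swapAt i k ≡ k
  swapAt-fixes         fzero    fzero           k≢i k≢i+1 = ⊥-elim (k≢i refl)
  swapAt-fixes         fzero    (fsuc fzero)    k≢i k≢i+1 = ⊥-elim (k≢i+1 refl)
  swapAt-fixes         fzero    (fsuc (fsuc k)) k≢i k≢i+1 = refl
  swapAt-fixes {suc n} (fsuc i) fzero           k≢i k≢i+1 = refl
  swapAt-fixes {suc n} (fsuc i) (fsuc k)        k≢i k≢i+1 =
    cong fsuc (swapAt-fixes i k (k≢i ∘′ cong fsuc) (k≢i+1 ∘′ cong fsuc))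

  swapAt-punchIn-suc : ∀ {n} (i c : Fin (suc n)) → swapAt i (punchIn (fsuc i) c) ≡ punchIn (inject₁ i) c
  swapAt-punchIn-suc         fzero    fzero    = refl
  swapAt-punchIn-suc {suc n} fzero    (fsuc c) = refl
  swapAt-punchIn-suc {suc n} (fsuc i) fzero    = refl
  swapAt-punchIn-suc {suc n} (fsuc i) (fsuc c) = cong fsuc (swapAt-punchIn-suc i c)

  swapAt-punchIn-inject₁ : ∀ {n} (i c : Fin (suc n)) → swapAt i (punchIn (inject₁ i) c) ≡ punchIn (fsuc i) c
  swapAt-punchIn-inject₁         fzero    fzero    = refl
  swapAt-punchIn-inject₁ {suc n} fzero    (fsuc c) = refl
  swapAt-punchIn-inject₁ {suc n} (fsuc i) fzero    = refl
  swapAt-punchIn-inject₁ {suc n} (fsuc i) (fsuc c) = cong fsuc (swapAt-punchIn-inject₁ i c)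

  swapAt-punchIn : ∀ {n} (i : Fin (suc (suc n))) k → k ≢ inject₁ i → k ≢ fsuc i →
    Σ (Fin (suc n)) λ i′ → ∀ c → swapAt i (punchIn k c) ≡ punchIn k (swapAt i′ c)
  swapAt-punchIn fzero fzero k≢i k≢i+1 = ⊥-elim (k≢i refl)
  swapAt-punchIn fzero (fsuc fzero) k≢i k≢i+1 = ⊥-elim (k≢i+1 refl)
  swapAt-punchIn fzero (fsuc (fsuc k)) k≢i k≢i+1 =
    fzero , λ { fzero → refl ; (fsuc fzero) → refl ; (fsuc (fsuc c)) → refl }
  swapAt-punchIn (fsuc i) fzero k≢i k≢i+1 = i , λ c → refl
  swapAt-punchIn {zero} (fsuc fzero) (fsuc fzero) k≢i k≢i+1 = ⊥-elim (k≢i refl)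
  swapAt-punchIn {zero} (fsuc fzero) (fsuc (fsuc fzero)) k≢i k≢i+1 = ⊥-elim (k≢i+1 refl)
  swapAt-punchIn {suc n} (fsuc i) (fsuc k) k≢i k≢i+1
    with i′ , commutes ← swapAt-punchIn i k (λ e → k≢i (cong fsuc e)) (λ e → k≢i+1 (cong fsuc e)) =
    fsuc i′ , λ { fzero → refl ; (fsuc c) → cong fsuc (commutes c) }

  sumFin-swapAt : ∀ {n} (i : Fin (suc n)) (f : Fin (suc (suc n)) → ℤ) → sumFin f ≡ sumFin (λ k → f (swapAt i k))
  sumFin-swapAt fzero f = exchange (f fzero) (f (fsuc fzero)) _
    where
    exchange : ∀ a b c → a + (b + c) ≡ b + (a + c)
    exchange = solve-∀
  sumFin-swapAt {suc n} (fsuc i) f = cong (_+_ (f fzero)) (sumFin-swapAt i (λ k → f (fsuc k)))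

  det-swapColumns : ∀ {n} (i : Fin (suc n)) (M : Matrix (suc (suc n))) → det (λ r c → M r (swapAt i c)) ≡ - det M
  det-swapColumns {n} i M = begin
    sumFin (λ k → signFin k * (M′ fzero k * cofactor M′ k))
      ≡⟨ sumFin-swapAt i (λ k → signFin k * (M′ fzero k * cofactor M′ k)) ⟩
    sumFin (λ k → signFin (swapAt i k) * (M fzero (swapAt i (swapAt i k)) * cofactor M′ (swapAt i k)))
      ≡⟨ sumFin-cong (λ k → cong (λ c → signFin (swapAt i k) * (M fzero c * cofactor M′ (swapAt i k))) (swapAt-involutive i k)) ⟩
    sumFin (λ k → signFin (swapAt i k) * (M fzero k * cofactor M′ (swapAt i k)))
      ≡⟨ sumFin-cong (λ k → trans (regroup (signFin (swapAt i k)) (M fzero k) _)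
                                  (cong (M fzero k *_) (signed-cofactor-swap k))) ⟩
    sumFin (λ k → M fzero k * - (signFin k * cofactor M k))
      ≡⟨ sumFin-cong (λ k → regroup-neg (M fzero k) (signFin k) (cofactor M k)) ⟩
    sumFin (λ k → - (signFin k * (M fzero k * cofactor M k)))
      ≡⟨ sumFin-neg (λ k → signFin k * (M fzero k * cofactor M k)) ⟩
    - det M ∎
    where
    open ≡-Reasoning
    M′ : Matrix (suc (suc n))
    M′ r c = M r (swapAt i c)
    cofactor : Matrix (suc (suc n)) → Fin (suc (suc n)) → ℤ
    cofactor A k = det (minor A k)
    regroup : ∀ s m d → s * (m * d) ≡ m * (s * d)
    regroup = solve-∀
    regroup-neg : ∀ m s d → m * - (s * d) ≡ - (s * (m * d))
    regroup-neg = solve-∀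
    signed-cofactor-swap : ∀ k → signFin (swapAt i k) * cofactor M′ (swapAt i k) ≡ - (signFin k * cofactor M k)
    signed-cofactor-swap k with k ≟ inject₁ i | k ≟ fsuc i
    ... | yes refl | _ = begin
      signFin (swapAt i (inject₁ i)) * cofactor M′ (swapAt i (inject₁ i))
        ≡⟨ cong (λ k → signFin k * cofactor M′ k) (swapAt-inject₁ i) ⟩
      - signFin i * cofactor M′ (fsuc i)
        ≡⟨ cong₂ _*_ (cong -_ (sym (signFin-inject₁ i)))
                     (det-cong (λ r c → cong (M (fsuc r)) (swapAt-punchIn-suc i c))) ⟩
      - signFin (inject₁ i) * cofactor M (inject₁ i)
        ≡⟨ ℤ.neg-distribˡ-* (signFin (inject₁ i)) _ ⟨
      - (signFin (inject₁ i) * cofactor M (inject₁ i)) ∎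
    ... | no _ | yes refl = begin
      signFin (swapAt i (fsuc i)) * cofactor M′ (swapAt i (fsuc i))
        ≡⟨ cong (λ k → signFin k * cofactor M′ k) (swapAt-suc i) ⟩
      signFin (inject₁ i) * cofactor M′ (inject₁ i)
        ≡⟨ cong₂ _*_ (trans (signFin-inject₁ i) (sym (ℤ.neg-involutive (signFin i))))
                     (det-cong (λ r c → cong (M (fsuc r)) (swapAt-punchIn-inject₁ i c))) ⟩
      - signFin (fsuc i) * cofactor M (fsuc i)
        ≡⟨ ℤ.neg-distribˡ-* (signFin (fsuc i)) _ ⟨
      - (signFin (fsuc i) * cofactor M (fsuc i)) ∎
    ... | no k≢i | no k≢i+1 = away n i M k k≢i k≢i+1
      where
      away : ∀ n (i : Fin (suc n)) (M : Matrix (suc (suc n))) k → k ≢ inject₁ i → k ≢ fsuc i →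
        signFin (swapAt i k) * det (minor (λ r c → M r (swapAt i c)) (swapAt i k)) ≡ - (signFin k * det (minor M k))
      away zero fzero M fzero k≢i k≢i+1 = ⊥-elim (k≢i refl)
      away zero fzero M (fsuc fzero) k≢i k≢i+1 = ⊥-elim (k≢i+1 refl)
      away (suc n) i M k k≢i k≢i+1 with i′ , commutes ← swapAt-punchIn i k k≢i k≢i+1 = begin
        signFin (swapAt i k) * det (minor (λ r c → M r (swapAt i c)) (swapAt i k))
          ≡⟨ cong (λ k → signFin k * det (minor (λ r c → M r (swapAt i c)) k)) (swapAt-fixes i k k≢i k≢i+1) ⟩
        signFin k * det (λ r c → M (fsuc r) (swapAt i (punchIn k c)))
          ≡⟨ cong (signFin k *_) (det-cong (λ r c → cong (M (fsuc r)) (commutes c))) ⟩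
        signFin k * det (λ r c → minor M k r (swapAt i′ c))
          ≡⟨ cong (signFin k *_) (det-swapColumns i′ (minor M k)) ⟩
        signFin k * - det (minor M k)
          ≡⟨ ℤ.neg-distribʳ-* (signFin k) _ ⟨
        - (signFin k * det (minor M k)) ∎

  -- Total version of punchOut: the position of l once index j is deleted (junk value when l ≡ j).
  punchOut′ : ∀ {m} → Fin (suc (suc m)) → Fin (suc (suc m)) → Fin (suc m)
  punchOut′         fzero    fzero    = fzero
  punchOut′         fzero    (fsuc l) = l
  punchOut′         (fsuc j) fzero    = fzero
  punchOut′ {zero}  (fsuc j) (fsuc l) = fzero
  punchOut′ {suc m} (fsuc j) (fsuc l) = fsuc (punchOut′ j l)

  punchOut′-punchIn : ∀ {m} (j : Fin (suc (suc m))) k → punchOut′ j (punchIn j k) ≡ k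
  punchOut′-punchIn         fzero    k        = refl
  punchOut′-punchIn         (fsuc j) fzero    = refl
  punchOut′-punchIn {suc m} (fsuc j) (fsuc k) = cong fsuc (punchOut′-punchIn j k)

  punchIn-punchIn-comm : ∀ {m} (j l : Fin (suc (suc m))) → j ≢ l → (c : Fin m) →
    punchIn j (punchIn (punchOut′ j l) c) ≡ punchIn l (punchIn (punchOut′ l j) c)
  punchIn-punchIn-comm fzero fzero j≢l c = ⊥-elim (j≢l refl)
  punchIn-punchIn-comm fzero (fsuc l) j≢l c = refl
  punchIn-punchIn-comm (fsuc j) fzero j≢l c = refl
  punchIn-punchIn-comm {zero} (fsuc fzero) (fsuc fzero) j≢l c = ⊥-elim (j≢l refl)
  punchIn-punchIn-comm {suc m} (fsuc j) (fsuc l) j≢l fzero = refl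
  punchIn-punchIn-comm {suc m} (fsuc j) (fsuc l) j≢l (fsuc c) =
    cong fsuc (punchIn-punchIn-comm j l (λ e → j≢l (cong fsuc e)) c)

  -- Laplace expansion along two rows a and b; Φ j l stands for the complementary minor
  -- of the columns j and l, and so should be symmetric.
  expand₂ : ∀ {m} (a b : Fin (suc m) → ℤ) (Φ : Fin (suc m) → Fin (suc m) → ℤ) → ℤ
  expand₂ a b Φ = sumFin λ j → signFin j * (a j * sumFin λ k → signFin k * (b (punchIn j k) * Φ j (punchIn j k)))

  module _ {m : ℕ} (a b : Fin (suc (suc m)) → ℤ) (Φ : Fin (suc (suc m)) → Fin (suc (suc m)) → ℤ) where

    private
      a′ b′ : Fin (suc m) → ℤ
      a′ j = a (fsuc j)
      b′ j = b (fsuc j)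
      Φ′ : Fin (suc m) → Fin (suc m) → ℤ
      Φ′ j l = Φ (fsuc j) (fsuc l)

    row₀-at-column₀ row₁-at-column₀ expand₂-column₀ : ℤ
    row₀-at-column₀ = sumFin (λ k → signFin k * (a fzero * (b (fsuc k) * Φ fzero (fsuc k))))
    row₁-at-column₀ = sumFin (λ k → signFin k * (a (fsuc k) * (b fzero * Φ fzero (fsuc k))))
    expand₂-column₀ = row₀-at-column₀ + - row₁-at-column₀

    expand₂-split : (∀ j → Φ (fsuc j) fzero ≡ Φ fzero (fsuc j)) →
      expand₂ a b Φ ≡ expand₂-column₀ + expand₂ a′ b′ Φ′
    expand₂-split Φ-sym₀ =
      trans (cong₂ _+_ first-row-at-column₀ first-row-elsewhere)
            (sym (ℤ.+-assoc row₀-at-column₀ (- row₁-at-column₀) (expand₂ a′ b′ Φ′)))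
      where
      open ≡-Reasoning
      inner : Fin (suc m) → ℤ
      inner j = sumFin (λ k → signFin k * (b′ (punchIn j k) * Φ′ j (punchIn j k)))
      first-row-at-column₀ : + 1 * (a fzero * sumFin (λ k → signFin k * (b (fsuc k) * Φ fzero (fsuc k))))
                           ≡ sumFin (λ k → signFin k * (a fzero * (b (fsuc k) * Φ fzero (fsuc k))))
      first-row-at-column₀ =
        trans (ℤ.*-identityˡ (a fzero * sumFin (λ k → signFin k * (b (fsuc k) * Φ fzero (fsuc k)))))
        (trans (*-distribˡ-sumFin (a fzero) (λ k → signFin k * (b (fsuc k) * Φ fzero (fsuc k))))
               (sumFin-cong (λ k → swap-factors (a fzero) (signFin k) (b (fsuc k) * Φ fzero (fsuc k)))))
        where
        swap-factors : ∀ x s y → x * (s * y) ≡ s * (x * y)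
        swap-factors = solve-∀
      second-row : ∀ j → sumFin (λ k → signFin k * (b (punchIn (fsuc j) k) * Φ (fsuc j) (punchIn (fsuc j) k)))
                       ≡ b fzero * Φ fzero (fsuc j) + - inner j
      second-row j = cong₂ _+_
        (trans (ℤ.*-identityˡ (b fzero * Φ (fsuc j) fzero)) (cong (b fzero *_) (Φ-sym₀ j)))
        (trans (sumFin-cong (λ k → sym (ℤ.neg-distribˡ-* (signFin k) (b′ (punchIn j k) * Φ′ j (punchIn j k)))))
               (sumFin-neg (λ k → signFin k * (b′ (punchIn j k) * Φ′ j (punchIn j k)))))
      first-row-elsewhere :
        sumFin (λ j → signFin (fsuc j) * (a (fsuc j) * sumFin (λ k → signFin k * (b (punchIn (fsuc j) k) * Φ (fsuc j) (punchIn (fsuc j) k)))))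
        ≡ - row₁-at-column₀ + expand₂ a′ b′ Φ′
      first-row-elsewhere = begin
        _ ≡⟨ sumFin-cong (λ j → cong (λ z → - signFin j * (a′ j * z)) (second-row j)) ⟩
        sumFin (λ j → - signFin j * (a′ j * (b fzero * Φ fzero (fsuc j) + - inner j)))
          ≡⟨ sumFin-cong (λ j → expand (signFin j) (a′ j) (b fzero * Φ fzero (fsuc j)) (inner j)) ⟩
        sumFin (λ j → - (signFin j * (a′ j * (b fzero * Φ fzero (fsuc j)))) + signFin j * (a′ j * inner j))
          ≡⟨ sumFin-distrib-+ (λ j → - (signFin j * (a′ j * (b fzero * Φ fzero (fsuc j))))) (λ j → signFin j * (a′ j * inner j)) ⟩
        sumFin (λ j → - (signFin j * (a′ j * (b fzero * Φ fzero (fsuc j))))) + expand₂ a′ b′ Φ′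
          ≡⟨ cong (_+ expand₂ a′ b′ Φ′) (sumFin-neg (λ j → signFin j * (a′ j * (b fzero * Φ fzero (fsuc j))))) ⟩
        _ ∎
        where
        expand : ∀ s x y z → - s * (x * (y + - z)) ≡ - (s * (x * y)) + s * (x * z)
        expand = solve-∀

  expand₂-antisym : ∀ {m} (a b : Fin (suc m) → ℤ) (Φ : Fin (suc m) → Fin (suc m) → ℤ) →
    (∀ j l → Φ j l ≡ Φ l j) → expand₂ a b Φ ≡ - expand₂ b a Φ
  expand₂-antisym {zero} a b Φ Φ-sym = trans (vanishes a b) (cong -_ (sym (vanishes b a)))
    where
    vanishes : ∀ a b → expand₂ a b Φ ≡ + 0
    vanishes a b = cong₂ _+_ (trans (cong (+ 1 *_) (ℤ.*-zeroʳ (a fzero))) refl) refl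
  expand₂-antisym {suc m} a b Φ Φ-sym = begin
    expand₂ a b Φ                                   ≡⟨ expand₂-split a b Φ (λ j → Φ-sym (fsuc j) fzero) ⟩
    expand₂-column₀ a b Φ + expand₂ a′ b′ Φ′         ≡⟨ cong₂ _+_ column₀-antisym (expand₂-antisym a′ b′ Φ′ (λ j l → Φ-sym (fsuc j) (fsuc l))) ⟩
    - expand₂-column₀ b a Φ + - expand₂ b′ a′ Φ′     ≡⟨ ℤ.neg-distrib-+ (expand₂-column₀ b a Φ) _ ⟨
    - (expand₂-column₀ b a Φ + expand₂ b′ a′ Φ′)     ≡⟨ cong -_ (expand₂-split b a Φ (λ j → Φ-sym (fsuc j) fzero)) ⟨
    - expand₂ b a Φ                                 ∎
    where
    open ≡-Reasoning
    a′ = λ j → a (fsuc j)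
    b′ = λ j → b (fsuc j)
    Φ′ = λ j l → Φ (fsuc j) (fsuc l)
    swap-rows : ∀ s x y z → s * (x * (y * z)) ≡ s * (y * (x * z))
    swap-rows = solve-∀
    column₀-antisym : expand₂-column₀ a b Φ ≡ - expand₂-column₀ b a Φ
    column₀-antisym = trans
      (cong₂ (λ u v → u + - v) (sumFin-cong (λ k → swap-rows (signFin k) (a fzero) (b (fsuc k)) (Φ fzero (fsuc k))))
                               (sumFin-cong (λ k → swap-rows (signFin k) (a (fsuc k)) (b fzero) (Φ fzero (fsuc k)))))
      (antisym (row₁-at-column₀ b a Φ) (row₀-at-column₀ b a Φ))
      where
      antisym : ∀ u v → u + - v ≡ - (v + - u)
      antisym = solve-∀

  det-swapRows₀₁ : ∀ {N} (M : Matrix (suc (suc N))) → det (λ r c → M (swapAt fzero r) c) ≡ - det M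
  det-swapRows₀₁ {N} M =
    trans (as-expand₂ (λ r c → M (swapAt fzero r) c) (λ r → refl))
    (trans (expand₂-antisym (M (fsuc fzero)) (M fzero) Φ Φ-sym)
           (cong -_ (sym (as-expand₂ M (λ r → refl)))))
    where
    Φ : Fin (suc (suc N)) → Fin (suc (suc N)) → ℤ
    Φ j l = det (λ r c → M (fsuc (fsuc r)) (punchIn j (punchIn (punchOut′ j l) c)))
    Φ-sym : ∀ j l → Φ j l ≡ Φ l j
    Φ-sym j l with j ≟ l
    ... | yes refl = refl
    ... | no j≢l = det-cong (λ r c → cong (M (fsuc (fsuc r))) (punchIn-punchIn-comm j l j≢l c))
    as-expand₂ : (M′ : Matrix (suc (suc N))) → (∀ r → M′ (fsuc (fsuc r)) ≡ M (fsuc (fsuc r))) →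
      det M′ ≡ expand₂ (M′ fzero) (M′ (fsuc fzero)) Φ
    as-expand₂ M′ same = sumFin-cong λ j → cong (λ z → signFin j * (M′ fzero j * z)) (sumFin-cong λ k →
      cong (λ z → signFin k * (M′ (fsuc fzero) (punchIn j k) * z)) (det-cong λ r c →
        trans (cong (λ row → row (punchIn j (punchIn k c))) (same r))
              (cong (λ z → M (fsuc (fsuc r)) (punchIn j (punchIn z c))) (sym (punchOut′-punchIn j k)))))

  det-swapRows : ∀ {n} (i : Fin (suc n)) (M : Matrix (suc (suc n))) → det (λ r c → M (swapAt i r) c) ≡ - det M
  det-swapRows fzero M = det-swapRows₀₁ M
  det-swapRows {suc n} (fsuc i) M =
    trans (sumFin-cong (λ j → trans (cong (λ z → signFin j * (M fzero j * z)) (det-swapRows i (minor M j)))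
                                    (pull-neg (signFin j) (M fzero j) _)))
          (sumFin-neg (λ j → signFin j * (M fzero j * det (minor M j))))
    where
    pull-neg : ∀ s x y → s * (x * - y) ≡ - (s * (x * y))
    pull-neg = solve-∀

  det-conjugate-swapAt : ∀ {n} (i : Fin (suc n)) (M : Matrix (suc (suc n))) →
    det (λ r c → M (swapAt i r) (swapAt i c)) ≡ det M
  det-conjugate-swapAt i M =
    trans (det-swapRows i (λ r c → M r (swapAt i c)))
          (trans (cong -_ (det-swapColumns i M)) (ℤ.neg-involutive (det M)))

  det-equalRows₀₁ : ∀ {N} (M : Matrix (suc (suc N))) → (∀ c → M fzero c ≡ M (fsuc fzero) c) → det M ≡ + 0
  det-equalRows₀₁ M rows≡ = self-negative (det M) (trans (det-cong rows-swapped) (det-swapRows₀₁ M))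
    where
    rows-swapped : ∀ r c → M r c ≡ M (swapAt fzero r) c
    rows-swapped fzero               c = rows≡ c
    rows-swapped (fsuc fzero)        c = sym (rows≡ c)
    rows-swapped (fsuc (fsuc r))     c = refl
    self-negative : ∀ x → x ≡ - x → x ≡ + 0
    self-negative (+ zero) _ = refl

  δ-refl : ∀ {N} (i : Fin N) → δ i i ≡ + 1
  δ-refl fzero    = refl
  δ-refl (fsuc i) = δ-refl i

  δ-≢ : ∀ {N} (i j : Fin N) → i ≢ j → δ i j ≡ + 0
  δ-≢ fzero    fzero    i≢j = ⊥-elim (i≢j refl)
  δ-≢ fzero    (fsuc j) i≢j = refl
  δ-≢ (fsuc i) fzero    i≢j = refl
  δ-≢ (fsuc i) (fsuc j) i≢j = δ-≢ i j (λ e → i≢j (cong fsuc e))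

  δ-swapAt : ∀ {n} (k : Fin (suc n)) i j → δ (swapAt k i) (swapAt k j) ≡ δ i j
  δ-swapAt k i j with i ≟ j
  ... | yes refl = trans (δ-refl (swapAt k i)) (sym (δ-refl i))
  ... | no i≢j   = trans (δ-≢ _ _ (λ e → i≢j (trans (sym (swapAt-involutive k i))
                                                (trans (cong (swapAt k) e) (swapAt-involutive k j)))))
                         (sym (δ-≢ i j i≢j))

module TypeMatrix where
  open import Defs
  open Determinant
  open import Data.Nat as ℕ using (ℕ; zero; suc; z≤n; s≤s)
  import Data.Nat.Properties as ℕ
  open import Data.Nat.Tactic.RingSolver using () renaming (solve-∀ to ℕ-solve-∀)
  open import Data.Fin using (Fin; toℕ; punchIn; inject₁) renaming (zero to fzero; suc to fsuc)
  open import Data.Fin.Properties using (_≟_; toℕ-inject₁; pigeonhole)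
  open import Data.Integer using (ℤ; +_; -_; _+_; _*_)
  import Data.Integer.Properties as ℤ
  open import Data.Integer.Tactic.RingSolver using (solve-∀)
  open import Data.Empty using (⊥-elim)
  open import Data.Product using (Σ; ∃₂; _×_; _,_)
  open import Relation.Binary.PropositionalEquality
  open import Relation.Nullary using (yes; no; Dec)

  Type : Set
  Type = Fin 3

  pattern X = fzero
  pattern Y = fsuc fzero
  pattern Z = fsuc (fsuc fzero)

  weight : Type → Type → ℤ
  weight Y Y = + 0
  weight Z Z = + 0
  weight _ _ = + 1

  shift : ℤ → Type → ℤ
  shift x T = x + weight T T

  -- x I - A for the graph in which i and j are adjacent iff weight (t i) (t j) ≡ 1;
  -- the diagonal is written as (x + w) - w to make the rows of equal type differ by a multiple of δ.
  typeMatrix : ∀ {N} → ℤ → (Fin N → Type) → Matrix N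
  typeMatrix x t i j = shift x (t i) * δ i j + - weight (t i) (t j)

  indicator : Type → Type → ℕ
  indicator X X = 1
  indicator Y Y = 1
  indicator Z Z = 1
  indicator _ _ = 0

  count : ∀ {N} → (Fin N → Type) → Type → ℕ
  count {zero}  t U = 0
  count {suc N} t U = indicator (t fzero) U ℕ.+ count (λ i → t (fsuc i)) U

  count-swapAt : ∀ {n} (k : Fin (suc n)) (t : Fin (suc (suc n)) → Type) U → count (λ i → t (swapAt k i)) U ≡ count t U
  count-swapAt fzero t U = exchange (indicator (t (fsuc fzero)) U) (indicator (t fzero) U) _
    where
    exchange : ∀ a b c → a ℕ.+ (b ℕ.+ c) ≡ b ℕ.+ (a ℕ.+ c)
    exchange = ℕ-solve-∀
  count-swapAt {suc n} (fsuc k) t U = cong (indicator (t fzero) U ℕ.+_) (count-swapAt k (λ i → t (fsuc i)) U)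

  det-typeMatrix-swapAt : ∀ {n} x (k : Fin (suc n)) (t : Fin (suc (suc n)) → Type) →
    det (typeMatrix x (λ i → t (swapAt k i))) ≡ det (typeMatrix x t)
  det-typeMatrix-swapAt x k t =
    trans (det-cong (λ r c → cong (λ d → shift x (t (swapAt k r)) * d + - weight (t (swapAt k r)) (t (swapAt k c)))
                                  (sym (δ-swapAt k r c))))
          (det-conjugate-swapAt k (typeMatrix x t))

  det-typeMatrix-retype : ∀ {N} x (t t′ : Fin N → Type) → (∀ i → t i ≡ t′ i) → det (typeMatrix x t) ≡ det (typeMatrix x t′)
  det-typeMatrix-retype x t t′ t≗t′ =
    det-cong (λ r c → cong₂ (λ a b → shift x a * δ r c + - weight a b) (t≗t′ r) (t≗t′ c))

  -- Rows 0 and 1 of equal type differ by d (e₀ - e₁): subtracting row 1 from row 0 leaves a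
  -- matrix whose determinant is d times two cofactors, one of which expands once more.
  det-typeMatrix-step : ∀ {N} x (t : Fin (suc (suc N)) → Type) → t fzero ≡ t (fsuc fzero) →
    let d  = shift x (t (fsuc fzero))
        D₁ = det (typeMatrix x (λ i → t (fsuc i)))
        D₂ = det (typeMatrix x (λ i → t (fsuc (fsuc i))))
    in det (typeMatrix x t) ≡ d * (D₁ + (D₁ + - (d * D₂)))
  det-typeMatrix-step {N} x t t₀≡t₁ = begin
    det M
      ≡⟨ sumFin-cong (λ j → cong (λ z → signFin j * (z * D j)) (row₀ j)) ⟩
    sumFin (λ j → signFin j * ((M (fsuc fzero) j + w j) * D j))
      ≡⟨ sumFin-cong (λ j → distrib (signFin j) (M (fsuc fzero) j) (w j) (D j)) ⟩
    sumFin (λ j → signFin j * (M (fsuc fzero) j * D j) + signFin j * (w j * D j))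
      ≡⟨ sumFin-distrib-+ (λ j → signFin j * (M (fsuc fzero) j * D j)) (λ j → signFin j * (w j * D j)) ⟩
    det row₁-doubled + sumFin (λ j → signFin j * (w j * D j))
      ≡⟨ cong₂ _+_ (det-equalRows₀₁ row₁-doubled (λ c → refl))
                   (cong (λ u → + 1 * (d * (+ 1 + - + 0) * D fzero) + (- + 1 * (d * (+ 0 + - + 1) * D (fsuc fzero)) + u))
                         (sumFin-zero _ (λ j → vanish (signFin (fsuc (fsuc j))) d (D (fsuc (fsuc j)))))) ⟩
    + 0 + (+ 1 * (d * (+ 1 + - + 0) * D fzero) + (- + 1 * (d * (+ 0 + - + 1) * D (fsuc fzero)) + + 0))
      ≡⟨ two-terms d (D fzero) (D (fsuc fzero)) ⟩
    d * D₁ + d * D (fsuc fzero)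
      ≡⟨ cong (λ z → d * D₁ + d * z) cofactor₁ ⟩
    d * D₁ + d * (D₁ + - (d * D₂))
      ≡⟨ ℤ.*-distribˡ-+ d D₁ _ ⟨
    d * (D₁ + (D₁ + - (d * D₂))) ∎
    where
    open ≡-Reasoning
    M = typeMatrix x t
    t₁ = λ i → t (fsuc i)
    M₁ = typeMatrix x t₁
    d = shift x (t (fsuc fzero))
    D₁ = det M₁
    D₂ = det (typeMatrix x (λ i → t (fsuc (fsuc i))))
    D : Fin (suc (suc N)) → ℤ
    D j = det (minor M j)
    w : Fin (suc (suc N)) → ℤ
    w j = d * (δ {suc (suc N)} fzero j + - δ (fsuc fzero) j)
    row₀ : ∀ j → M fzero j ≡ M (fsuc fzero) j + w j
    row₀ j rewrite t₀≡t₁ = split d (δ {suc (suc N)} fzero j) (δ (fsuc fzero) j) (weight (t (fsuc fzero)) (t j))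
      where
      split : ∀ d a b c → d * a + - c ≡ d * b + - c + d * (a + - b)
      split = solve-∀
    row₁-doubled : Matrix (suc (suc N))
    row₁-doubled fzero    c = M (fsuc fzero) c
    row₁-doubled (fsuc r) c = M (fsuc r) c
    distrib : ∀ s a b c → s * ((a + b) * c) ≡ s * (a * c) + s * (b * c)
    distrib = solve-∀
    vanish : ∀ s d y → s * (d * (+ 0 + - + 0) * y) ≡ + 0
    vanish = solve-∀
    two-terms : ∀ d a b → + 0 + (+ 1 * (d * (+ 1 + - + 0) * a) + (- + 1 * (d * (+ 0 + - + 1) * b) + + 0)) ≡ d * a + d * b
    two-terms = solve-∀
    E : Fin (suc N) → ℤ
    E j = det (minor M₁ j)
    lower-rows : ∀ r c → minor M (fsuc fzero) (fsuc r) c ≡ M₁ (fsuc r) c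
    lower-rows r fzero rewrite t₀≡t₁ = refl
    lower-rows r (fsuc c) = refl
    row₀-of-minor : ∀ j → M (fsuc fzero) (punchIn (fsuc fzero) j) ≡ M₁ fzero j + - (d * δ {suc N} fzero j)
    row₀-of-minor fzero rewrite t₀≡t₁ = diagonal d (weight (t (fsuc fzero)) (t (fsuc fzero)))
      where
      diagonal : ∀ d c → d * + 0 + - c ≡ d * + 1 + - c + - (d * + 1)
      diagonal = solve-∀
    row₀-of-minor (fsuc j) = off-diagonal d (weight (t (fsuc fzero)) (t (fsuc (fsuc j))))
      where
      off-diagonal : ∀ d c → d * + 0 + - c ≡ d * + 0 + - c + - (d * + 0)
      off-diagonal = solve-∀
    cofactor₁ : D (fsuc fzero) ≡ D₁ + - (d * D₂)
    cofactor₁ = begin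
      D (fsuc fzero)
        ≡⟨ sumFin-cong (λ j → cong₂ (λ u v → signFin j * (u * v)) (row₀-of-minor j) (det-cong (λ r c → lower-rows r (punchIn j c)))) ⟩
      sumFin (λ j → signFin j * ((M₁ fzero j + - (d * δ {suc N} fzero j)) * E j))
        ≡⟨ sumFin-cong (λ j → distrib (signFin j) (M₁ fzero j) (- (d * δ {suc N} fzero j)) (E j)) ⟩
      sumFin (λ j → signFin j * (M₁ fzero j * E j) + signFin j * (- (d * δ {suc N} fzero j) * E j))
        ≡⟨ sumFin-distrib-+ (λ j → signFin j * (M₁ fzero j * E j)) (λ j → signFin j * (- (d * δ {suc N} fzero j) * E j)) ⟩
      D₁ + (+ 1 * (- (d * + 1) * E fzero) + sumFin (λ j → signFin (fsuc j) * (- (d * + 0) * E (fsuc j))))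
        ≡⟨ cong (λ u → D₁ + (+ 1 * (- (d * + 1) * E fzero) + u)) (sumFin-zero _ (λ j → vanish′ (signFin (fsuc j)) d (E (fsuc j)))) ⟩
      D₁ + (+ 1 * (- (d * + 1) * D₂) + + 0)
        ≡⟨ cong (_+_ D₁) (one-term d D₂) ⟩
      D₁ + - (d * D₂) ∎
      where
      vanish′ : ∀ s d y → s * (- (d * + 0) * y) ≡ + 0
      vanish′ = solve-∀
      one-term : ∀ d y → + 1 * (- (d * + 1) * y) + + 0 ≡ - (d * y)
      one-term = solve-∀

  -- pow′ d n = n * d ^ (n - 1), the derivative of d ^ n, without a truncated exponent.
  pow′ : ℤ → ℕ → ℤ
  pow′ d zero    = + 0
  pow′ d (suc n) = d ^ᶻ n + d * pow′ d n

  -- The recurrence of det-typeMatrix-step, which both d ^ n and pow′ d n solve.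
  pow-pow′-recurrence : ∀ d a α β →
    let s : ℕ → ℤ
        s n = d ^ᶻ n * α + pow′ d n * β
    in s (suc (suc a)) ≡ d * (s (suc a) + (s (suc a) + - (d * s a)))
  pow-pow′-recurrence d a α β = recurrence d (d ^ᶻ a) (pow′ d a) α β
    where
    recurrence : ∀ d p q α β → d * (d * p) * α + (d * p + d * (p + d * q)) * β
                              ≡ d * ((d * p * α + (p + d * q) * β) + ((d * p * α + (p + d * q) * β) + - (d * (p * α + q * β))))
    recurrence = solve-∀

  -- The determinant of a type matrix with a, b, c vertices of types X, Y, Z is obtained by
  -- substituting (A₀, A₁) = ((x+1) ^ a, pow′ (x+1) a), (B₀, B₁) = (x ^ b, pow′ x b) and
  -- (C₀, C₁) = (x ^ c, pow′ x c); it is linear in each of the three pairs.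
  blockFormula : (A₀ A₁ B₀ B₁ C₀ C₁ : ℤ) → ℤ
  blockFormula A₀ A₁ B₀ B₁ C₀ C₁ =
    A₀ * B₀ * C₀ + - (A₁ * B₀ * C₀) + - (A₀ * B₁ * C₁) + - (A₁ * B₁ * C₀) + - (A₁ * B₀ * C₁) + - (A₁ * B₁ * C₁)

  blockFormula-linear₁ : ∀ A₀ A₁ B₀ B₁ C₀ C₁ → blockFormula A₀ A₁ B₀ B₁ C₀ C₁
    ≡ A₀ * (B₀ * C₀ + - (B₁ * C₁)) + A₁ * - (B₀ * C₀ + B₁ * C₀ + B₀ * C₁ + B₁ * C₁)
  blockFormula-linear₁ = by-ring
    where
    by-ring : ∀ A₀ A₁ B₀ B₁ C₀ C₁ → A₀ * B₀ * C₀ + - (A₁ * B₀ * C₀) + - (A₀ * B₁ * C₁) + - (A₁ * B₁ * C₀) + - (A₁ * B₀ * C₁) + - (A₁ * B₁ * C₁)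
      ≡ A₀ * (B₀ * C₀ + - (B₁ * C₁)) + A₁ * - (B₀ * C₀ + B₁ * C₀ + B₀ * C₁ + B₁ * C₁)
    by-ring = solve-∀

  blockFormula-linear₂ : ∀ A₀ A₁ B₀ B₁ C₀ C₁ → blockFormula A₀ A₁ B₀ B₁ C₀ C₁
    ≡ B₀ * (A₀ * C₀ + - (A₁ * C₀) + - (A₁ * C₁)) + B₁ * - (A₀ * C₁ + A₁ * C₀ + A₁ * C₁)
  blockFormula-linear₂ = by-ring
    where
    by-ring : ∀ A₀ A₁ B₀ B₁ C₀ C₁ → A₀ * B₀ * C₀ + - (A₁ * B₀ * C₀) + - (A₀ * B₁ * C₁) + - (A₁ * B₁ * C₀) + - (A₁ * B₀ * C₁) + - (A₁ * B₁ * C₁)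
      ≡ B₀ * (A₀ * C₀ + - (A₁ * C₀) + - (A₁ * C₁)) + B₁ * - (A₀ * C₁ + A₁ * C₀ + A₁ * C₁)
    by-ring = solve-∀

  blockFormula-linear₃ : ∀ A₀ A₁ B₀ B₁ C₀ C₁ → blockFormula A₀ A₁ B₀ B₁ C₀ C₁
    ≡ C₀ * (A₀ * B₀ + - (A₁ * B₀) + - (A₁ * B₁)) + C₁ * - (A₀ * B₁ + A₁ * B₀ + A₁ * B₁)
  blockFormula-linear₃ = by-ring
    where
    by-ring : ∀ A₀ A₁ B₀ B₁ C₀ C₁ → A₀ * B₀ * C₀ + - (A₁ * B₀ * C₀) + - (A₀ * B₁ * C₁) + - (A₁ * B₁ * C₀) + - (A₁ * B₀ * C₁) + - (A₁ * B₁ * C₁)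
      ≡ C₀ * (A₀ * B₀ + - (A₁ * B₀) + - (A₁ * B₁)) + C₁ * - (A₀ * B₁ + A₁ * B₀ + A₁ * B₁)
    by-ring = solve-∀

  detFormula : ℤ → ℕ → ℕ → ℕ → ℤ
  detFormula x a b c = blockFormula (shift x X ^ᶻ a) (pow′ (shift x X) a) (shift x Y ^ᶻ b) (pow′ (shift x Y) b)
                                     (shift x Z ^ᶻ c) (pow′ (shift x Z) c)

  detFormulaOf : ∀ {N} → ℤ → (Fin N → Type) → ℤ
  detFormulaOf x t = detFormula x (count t X) (count t Y) (count t Z)

  detFormula-stepX : ∀ x a b c → let d = shift x X in
    detFormula x (suc (suc a)) b c ≡ d * (detFormula x (suc a) b c + (detFormula x (suc a) b c + - (d * detFormula x a b c)))
  detFormula-stepX x a b c = begin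
    detFormula x (suc (suc a)) b c   ≡⟨ blockFormula-linear₁ (d ^ᶻ suc (suc a)) (pow′ d (suc (suc a))) B₀ B₁ C₀ C₁ ⟩
    s (suc (suc a))                  ≡⟨ pow-pow′-recurrence d a α β ⟩
    d * (s (suc a) + (s (suc a) + - (d * s a)))
      ≡⟨ sym (cong₂ (λ u v → d * (u + (u + - (d * v)))) (blockFormula-linear₁ (d ^ᶻ suc a) (pow′ d (suc a)) B₀ B₁ C₀ C₁)
                                                        (blockFormula-linear₁ (d ^ᶻ a) (pow′ d a) B₀ B₁ C₀ C₁)) ⟩
    d * (detFormula x (suc a) b c + (detFormula x (suc a) b c + - (d * detFormula x a b c))) ∎
    where
    open ≡-Reasoning
    d = shift x X
    B₀ = shift x Y ^ᶻ b
    B₁ = pow′ (shift x Y) b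
    C₀ = shift x Z ^ᶻ c
    C₁ = pow′ (shift x Z) c
    α = B₀ * C₀ + - (B₁ * C₁)
    β = - (B₀ * C₀ + B₁ * C₀ + B₀ * C₁ + B₁ * C₁)
    s : ℕ → ℤ
    s n = d ^ᶻ n * α + pow′ d n * β

  detFormula-stepY : ∀ x a b c → let d = shift x Y in
    detFormula x a (suc (suc b)) c ≡ d * (detFormula x a (suc b) c + (detFormula x a (suc b) c + - (d * detFormula x a b c)))
  detFormula-stepY x a b c = begin
    detFormula x a (suc (suc b)) c   ≡⟨ blockFormula-linear₂ A₀ A₁ (d ^ᶻ suc (suc b)) (pow′ d (suc (suc b))) C₀ C₁ ⟩
    s (suc (suc b))                  ≡⟨ pow-pow′-recurrence d b α β ⟩
    d * (s (suc b) + (s (suc b) + - (d * s b)))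
      ≡⟨ sym (cong₂ (λ u v → d * (u + (u + - (d * v)))) (blockFormula-linear₂ A₀ A₁ (d ^ᶻ suc b) (pow′ d (suc b)) C₀ C₁)
                                                        (blockFormula-linear₂ A₀ A₁ (d ^ᶻ b) (pow′ d b) C₀ C₁)) ⟩
    d * (detFormula x a (suc b) c + (detFormula x a (suc b) c + - (d * detFormula x a b c))) ∎
    where
    open ≡-Reasoning
    d = shift x Y
    A₀ = shift x X ^ᶻ a
    A₁ = pow′ (shift x X) a
    C₀ = shift x Z ^ᶻ c
    C₁ = pow′ (shift x Z) c
    α = A₀ * C₀ + - (A₁ * C₀) + - (A₁ * C₁)
    β = - (A₀ * C₁ + A₁ * C₀ + A₁ * C₁)
    s : ℕ → ℤ
    s n = d ^ᶻ n * α + pow′ d n * β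

  detFormula-stepZ : ∀ x a b c → let d = shift x Z in
    detFormula x a b (suc (suc c)) ≡ d * (detFormula x a b (suc c) + (detFormula x a b (suc c) + - (d * detFormula x a b c)))
  detFormula-stepZ x a b c = begin
    detFormula x a b (suc (suc c))   ≡⟨ blockFormula-linear₃ A₀ A₁ B₀ B₁ (d ^ᶻ suc (suc c)) (pow′ d (suc (suc c))) ⟩
    s (suc (suc c))                  ≡⟨ pow-pow′-recurrence d c α β ⟩
    d * (s (suc c) + (s (suc c) + - (d * s c)))
      ≡⟨ sym (cong₂ (λ u v → d * (u + (u + - (d * v)))) (blockFormula-linear₃ A₀ A₁ B₀ B₁ (d ^ᶻ suc c) (pow′ d (suc c)))
                                                        (blockFormula-linear₃ A₀ A₁ B₀ B₁ (d ^ᶻ c) (pow′ d c))) ⟩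
    d * (detFormula x a b (suc c) + (detFormula x a b (suc c) + - (d * detFormula x a b c))) ∎
    where
    open ≡-Reasoning
    d = shift x Z
    A₀ = shift x X ^ᶻ a
    A₁ = pow′ (shift x X) a
    B₀ = shift x Y ^ᶻ b
    B₁ = pow′ (shift x Y) b
    α = A₀ * B₀ + - (A₁ * B₀) + - (A₁ * B₁)
    β = - (A₀ * B₁ + A₁ * B₀ + A₁ * B₁)
    s : ℕ → ℤ
    s n = d ^ᶻ n * α + pow′ d n * β

  detFormulaOf-step : ∀ {N} x (t : Fin (suc (suc N)) → Type) → t fzero ≡ t (fsuc fzero) →
    let d  = shift x (t (fsuc fzero))
        F₁ = detFormulaOf x (λ i → t (fsuc i))
        F₂ = detFormulaOf x (λ i → t (fsuc (fsuc i)))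
    in detFormulaOf x t ≡ d * (F₁ + (F₁ + - (d * F₂)))
  detFormulaOf-step x t t₀≡t₁ rewrite t₀≡t₁ = by-type (t (fsuc fzero))
    where
    t₂ = λ i → t (fsuc (fsuc i))
    by-type : ∀ T → let d = shift x T
                        F₁ = detFormula x (indicator T X ℕ.+ count t₂ X) (indicator T Y ℕ.+ count t₂ Y) (indicator T Z ℕ.+ count t₂ Z)
                    in detFormula x (indicator T X ℕ.+ (indicator T X ℕ.+ count t₂ X)) (indicator T Y ℕ.+ (indicator T Y ℕ.+ count t₂ Y))
                                    (indicator T Z ℕ.+ (indicator T Z ℕ.+ count t₂ Z))
                       ≡ d * (F₁ + (F₁ + - (d * detFormulaOf x t₂)))
    by-type X = detFormula-stepX x (count t₂ X) (count t₂ Y) (count t₂ Z)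
    by-type Y = detFormula-stepY x (count t₂ X) (count t₂ Y) (count t₂ Z)
    by-type Z = detFormula-stepZ x (count t₂ X) (count t₂ Y) (count t₂ Z)

  det≡detFormula-step : ∀ {N} x (t : Fin (suc (suc N)) → Type) → t fzero ≡ t (fsuc fzero) →
    det (typeMatrix x (λ i → t (fsuc i))) ≡ detFormulaOf x (λ i → t (fsuc i)) →
    det (typeMatrix x (λ i → t (fsuc (fsuc i)))) ≡ detFormulaOf x (λ i → t (fsuc (fsuc i))) →
    det (typeMatrix x t) ≡ detFormulaOf x t
  det≡detFormula-step x t t₀≡t₁ ih₁ ih₂ =
    trans (det-typeMatrix-step x t t₀≡t₁)
    (trans (cong₂ (λ D₁ D₂ → d * (D₁ + (D₁ + - (d * D₂)))) ih₁ ih₂)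
           (sym (detFormulaOf-step x t t₀≡t₁)))
    where
    d = shift x (t (fsuc fzero))

  data Reorder {n} (t : Fin (suc (suc n)) → Type) : (Fin (suc (suc n)) → Type) → Set where
    done : Reorder t t
    swap : ∀ {t′} k → Reorder (λ i → t (swapAt k i)) t′ → Reorder t t′

  det-typeMatrix-reorder : ∀ {n} x {t t′ : Fin (suc (suc n)) → Type} → Reorder t t′ →
    det (typeMatrix x t) ≡ det (typeMatrix x t′)
  det-typeMatrix-reorder x done = refl
  det-typeMatrix-reorder x {t} (swap k r) = trans (sym (det-typeMatrix-swapAt x k t)) (det-typeMatrix-reorder x r)

  count-reorder : ∀ {n} {t t′ : Fin (suc (suc n)) → Type} → Reorder t t′ → ∀ U → count t U ≡ count t′ U
  count-reorder done U = refl
  count-reorder {t = t} (swap k r) U = trans (sym (count-swapAt k t U)) (count-reorder r U)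

  detFormulaOf-reorder : ∀ {n} x {t t′ : Fin (suc (suc n)) → Type} → Reorder t t′ → detFormulaOf x t ≡ detFormulaOf x t′
  detFormulaOf-reorder x r rewrite count-reorder r X | count-reorder r Y | count-reorder r Z = refl

  PairInFront : ∀ {n} → (Fin (suc (suc n)) → Type) → Set
  PairInFront t = Σ _ λ t′ → Reorder t t′ × t′ fzero ≡ t′ (fsuc fzero)

  -- The first argument is a fuel bounding the recursion: it is toℕ of the moving index.
  pairInFront-from₀ : ∀ (fuel : ℕ) {N} (t : Fin (suc (suc N)) → Type) (k : Fin (suc N)) →
    toℕ k ≡ fuel → t fzero ≡ t (fsuc k) → PairInFront t
  pairInFront-from₀ fuel t fzero _ t₀≡tₖ = t , done , t₀≡tₖ
  pairInFront-from₀ (suc fuel) {suc N} t (fsuc k) k≡fuel t₀≡tₖ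
    with t′ , r , t′₀≡t′₁ ← pairInFront-from₀ fuel (λ i → t (swapAt (fsuc k) i)) (inject₁ k)
                          (trans (toℕ-inject₁ k) (ℕ.suc-injective k≡fuel))
                          (trans t₀≡tₖ (sym (cong t (swapAt-inject₁ (fsuc k))))) =
    t′ , swap (fsuc k) r , t′₀≡t′₁

  pairInFront : ∀ (fuel : ℕ) {N} (t : Fin (suc (suc N)) → Type) (i j : Fin (suc (suc N))) →
    toℕ i ≡ fuel → toℕ i ℕ.< toℕ j → t i ≡ t j → PairInFront t
  pairInFront fuel t fzero (fsuc k) _ _ tᵢ≡tⱼ = pairInFront-from₀ (toℕ k) t k refl tᵢ≡tⱼ
  pairInFront (suc fuel) t (fsuc i) j i≡fuel i<j tᵢ≡tⱼ
    with pairInFront fuel (λ l → t (swapAt i l)) (inject₁ i) j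
           (trans (toℕ-inject₁ i) (ℕ.suc-injective i≡fuel)) inject₁i<j
           (trans (cong t (swapAt-inject₁ i)) (trans tᵢ≡tⱼ (cong t (sym (swapAt-fixes i j j≢i j≢i+1)))))
    where
    inject₁i<j : toℕ (inject₁ i) ℕ.< toℕ j
    inject₁i<j rewrite toℕ-inject₁ i = ℕ.<-trans (ℕ.n<1+n (toℕ i)) i<j
    j≢i : j ≢ inject₁ i
    j≢i refl = ℕ.<-irrefl refl inject₁i<j
    j≢i+1 : j ≢ fsuc i
    j≢i+1 refl = ℕ.<-irrefl refl i<j
  ... | t′ , r , t′₀≡t′₁ = t′ , swap i r , t′₀≡t′₁

  pair : Type → Type → Fin 2 → Type
  pair a b fzero    = a
  pair a b (fsuc _) = b

  triple : Type → Type → Type → Fin 3 → Type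
  triple a b c fzero           = a
  triple a b c (fsuc fzero)    = b
  triple a b c (fsuc (fsuc _)) = c

  -- The base cases: all types distinct, up to reordering. Each is proved by ring normalisation of
  -- the definitional unfoldings of both sides, which are written out in normal-forms.
  det≡detFormula-[X] : ∀ x → det (typeMatrix x (λ (_ : Fin 1) → X)) ≡ detFormulaOf x (λ (_ : Fin 1) → X)
  det≡detFormula-[X] = normal-forms
    where
    normal-forms : ∀ x →
      ((+ 1 * (((x + + 1) * + 1 + - + 1) * + 1)) + + 0)
      ≡ ((x + + 1) * + 1) * + 1 * + 1 + - ((+ 1 + (x + + 1) * + 0) * + 1 * + 1) + - (((x + + 1) * + 1) *
        + 0 * + 0) + - ((+ 1 + (x + + 1) * + 0) * + 0 * + 1) + - ((+ 1 + (x + + 1) * + 0) * + 1 * + 0) +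
        - ((+ 1 + (x + + 1) * + 0) * + 0 * + 0)
    normal-forms = solve-∀

  det≡detFormula-[Y] : ∀ x → det (typeMatrix x (λ (_ : Fin 1) → Y)) ≡ detFormulaOf x (λ (_ : Fin 1) → Y)
  det≡detFormula-[Y] = normal-forms
    where
    normal-forms : ∀ x →
      ((+ 1 * (((x + + 0) * + 1 + - + 0) * + 1)) + + 0)
      ≡ + 1 * ((x + + 0) * + 1) * + 1 + - (+ 0 * ((x + + 0) * + 1) * + 1) + - (+ 1 * (+ 1 + (x + + 0) *
        + 0) * + 0) + - (+ 0 * (+ 1 + (x + + 0) * + 0) * + 1) + - (+ 0 * ((x + + 0) * + 1) * + 0) + - (+ 0 *
        (+ 1 + (x + + 0) * + 0) * + 0)
    normal-forms = solve-∀

  det≡detFormula-[Z] : ∀ x → det (typeMatrix x (λ (_ : Fin 1) → Z)) ≡ detFormulaOf x (λ (_ : Fin 1) → Z)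
  det≡detFormula-[Z] = normal-forms
    where
    normal-forms : ∀ x →
      ((+ 1 * (((x + + 0) * + 1 + - + 0) * + 1)) + + 0)
      ≡ + 1 * + 1 * ((x + + 0) * + 1) + - (+ 0 * + 1 * ((x + + 0) * + 1)) + - (+ 1 * + 0 * (+ 1 + (x +
        + 0) * + 0)) + - (+ 0 * + 0 * ((x + + 0) * + 1)) + - (+ 0 * + 1 * (+ 1 + (x + + 0) * + 0)) + - (+ 0
        * + 0 * (+ 1 + (x + + 0) * + 0))
    normal-forms = solve-∀

  det≡detFormula-[X,Y] : ∀ x → det (typeMatrix x (pair X Y)) ≡ detFormulaOf x (pair X Y)
  det≡detFormula-[X,Y] = normal-forms
    where
    normal-forms : ∀ x →
      ((+ 1 * (((x + + 1) * + 1 + - + 1) * ((+ 1 * (((x + + 0) * + 1 + - + 0) * + 1)) + + 0))) + ((- + 1 *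
        (((x + + 1) * + 0 + - + 1) * ((+ 1 * (((x + + 0) * + 0 + - + 1) * + 1)) + + 0))) + + 0))
      ≡ ((x + + 1) * + 1) * ((x + + 0) * + 1) * + 1 + - ((+ 1 + (x + + 1) * + 0) * ((x + + 0) * + 1) *
        + 1) + - (((x + + 1) * + 1) * (+ 1 + (x + + 0) * + 0) * + 0) + - ((+ 1 + (x + + 1) * + 0) * (+ 1 +
        (x + + 0) * + 0) * + 1) + - ((+ 1 + (x + + 1) * + 0) * ((x + + 0) * + 1) * + 0) + - ((+ 1 + (x +
        + 1) * + 0) * (+ 1 + (x + + 0) * + 0) * + 0)
    normal-forms = solve-∀

  det≡detFormula-[X,Z] : ∀ x → det (typeMatrix x (pair X Z)) ≡ detFormulaOf x (pair X Z)
  det≡detFormula-[X,Z] = normal-forms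
    where
    normal-forms : ∀ x →
      ((+ 1 * (((x + + 1) * + 1 + - + 1) * ((+ 1 * (((x + + 0) * + 1 + - + 0) * + 1)) + + 0))) + ((- + 1 *
        (((x + + 1) * + 0 + - + 1) * ((+ 1 * (((x + + 0) * + 0 + - + 1) * + 1)) + + 0))) + + 0))
      ≡ ((x + + 1) * + 1) * + 1 * ((x + + 0) * + 1) + - ((+ 1 + (x + + 1) * + 0) * + 1 * ((x + + 0) *
        + 1)) + - (((x + + 1) * + 1) * + 0 * (+ 1 + (x + + 0) * + 0)) + - ((+ 1 + (x + + 1) * + 0) * + 0 *
        ((x + + 0) * + 1)) + - ((+ 1 + (x + + 1) * + 0) * + 1 * (+ 1 + (x + + 0) * + 0)) + - ((+ 1 + (x +
        + 1) * + 0) * + 0 * (+ 1 + (x + + 0) * + 0))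
    normal-forms = solve-∀

  det≡detFormula-[Y,Z] : ∀ x → det (typeMatrix x (pair Y Z)) ≡ detFormulaOf x (pair Y Z)
  det≡detFormula-[Y,Z] = normal-forms
    where
    normal-forms : ∀ x →
      ((+ 1 * (((x + + 0) * + 1 + - + 0) * ((+ 1 * (((x + + 0) * + 1 + - + 0) * + 1)) + + 0))) + ((- + 1 *
        (((x + + 0) * + 0 + - + 1) * ((+ 1 * (((x + + 0) * + 0 + - + 1) * + 1)) + + 0))) + + 0))
      ≡ + 1 * ((x + + 0) * + 1) * ((x + + 0) * + 1) + - (+ 0 * ((x + + 0) * + 1) * ((x + + 0) * + 1)) +
        - (+ 1 * (+ 1 + (x + + 0) * + 0) * (+ 1 + (x + + 0) * + 0)) + - (+ 0 * (+ 1 + (x + + 0) * + 0) * ((x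
        + + 0) * + 1)) + - (+ 0 * ((x + + 0) * + 1) * (+ 1 + (x + + 0) * + 0)) + - (+ 0 * (+ 1 + (x + + 0) *
        + 0) * (+ 1 + (x + + 0) * + 0))
    normal-forms = solve-∀

  det≡detFormula-[X,Y,Z] : ∀ x → det (typeMatrix x (triple X Y Z)) ≡ detFormulaOf x (triple X Y Z)
  det≡detFormula-[X,Y,Z] = normal-forms
    where
    normal-forms : ∀ x →
      ((+ 1 * (((x + + 1) * + 1 + - + 1) * ((+ 1 * (((x + + 0) * + 1 + - + 0) * ((+ 1 * (((x + + 0) * + 1
        + - + 0) * + 1)) + + 0))) + ((- + 1 * (((x + + 0) * + 0 + - + 1) * ((+ 1 * (((x + + 0) * + 0 +
        - + 1) * + 1)) + + 0))) + + 0)))) + ((- + 1 * (((x + + 1) * + 0 + - + 1) * ((+ 1 * (((x + + 0) * + 0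
        + - + 1) * ((+ 1 * (((x + + 0) * + 1 + - + 0) * + 1)) + + 0))) + ((- + 1 * (((x + + 0) * + 0 +
        - + 1) * ((+ 1 * (((x + + 0) * + 0 + - + 1) * + 1)) + + 0))) + + 0)))) + ((+ 1 * (((x + + 1) * + 0 +
        - + 1) * ((+ 1 * (((x + + 0) * + 0 + - + 1) * ((+ 1 * (((x + + 0) * + 0 + - + 1) * + 1)) + + 0))) +
        ((- + 1 * (((x + + 0) * + 1 + - + 0) * ((+ 1 * (((x + + 0) * + 0 + - + 1) * + 1)) + + 0))) + + 0))))
        + + 0)))
      ≡ ((x + + 1) * + 1) * ((x + + 0) * + 1) * ((x + + 0) * + 1) + - ((+ 1 + (x + + 1) * + 0) * ((x +
        + 0) * + 1) * ((x + + 0) * + 1)) + - (((x + + 1) * + 1) * (+ 1 + (x + + 0) * + 0) * (+ 1 + (x + + 0)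
        * + 0)) + - ((+ 1 + (x + + 1) * + 0) * (+ 1 + (x + + 0) * + 0) * ((x + + 0) * + 1)) + - ((+ 1 + (x +
        + 1) * + 0) * ((x + + 0) * + 1) * (+ 1 + (x + + 0) * + 0)) + - ((+ 1 + (x + + 1) * + 0) * (+ 1 + (x
        + + 0) * + 0) * (+ 1 + (x + + 0) * + 0))
    normal-forms = solve-∀

  det≡detFormula-single : ∀ x (t : Fin 1 → Type) → det (typeMatrix x t) ≡ detFormulaOf x t
  det≡detFormula-single x t = trans (det-typeMatrix-retype x t (λ _ → t fzero) (λ { fzero → refl })) (by-type (t fzero))
    where
    by-type : ∀ T → det (typeMatrix x (λ (_ : Fin 1) → T)) ≡ detFormulaOf x (λ (_ : Fin 1) → T)
    by-type X = det≡detFormula-[X] x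
    by-type Y = det≡detFormula-[Y] x
    by-type Z = det≡detFormula-[Z] x

  det-typeMatrix-swap : ∀ {n} x (k : Fin (suc n)) (t : Fin (suc (suc n)) → Type) {t′} → (∀ i → t (swapAt k i) ≡ t′ i) →
    det (typeMatrix x t) ≡ det (typeMatrix x t′)
  det-typeMatrix-swap x k t {t′} t∘swap≗t′ =
    trans (sym (det-typeMatrix-swapAt x k t)) (det-typeMatrix-retype x (λ i → t (swapAt k i)) t′ t∘swap≗t′)

  pair-swap : ∀ a b i → pair a b (swapAt fzero i) ≡ pair b a i
  pair-swap a b fzero        = refl
  pair-swap a b (fsuc fzero) = refl

  triple-swap₀₁ : ∀ a b c i → triple a b c (swapAt fzero i) ≡ triple b a c i
  triple-swap₀₁ a b c fzero               = refl
  triple-swap₀₁ a b c (fsuc fzero)        = refl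
  triple-swap₀₁ a b c (fsuc (fsuc fzero)) = refl

  triple-swap₁₂ : ∀ a b c i → triple a b c (swapAt (fsuc fzero) i) ≡ triple a c b i
  triple-swap₁₂ a b c fzero               = refl
  triple-swap₁₂ a b c (fsuc fzero)        = refl
  triple-swap₁₂ a b c (fsuc (fsuc fzero)) = refl

  det≡detFormula-distinct₂ : ∀ x a b → a ≢ b → det (typeMatrix x (pair a b)) ≡ detFormulaOf x (pair a b)
  det≡detFormula-distinct₂ x X X a≢b = ⊥-elim (a≢b refl)
  det≡detFormula-distinct₂ x Y Y a≢b = ⊥-elim (a≢b refl)
  det≡detFormula-distinct₂ x Z Z a≢b = ⊥-elim (a≢b refl)
  det≡detFormula-distinct₂ x X Y _ = det≡detFormula-[X,Y] x
  det≡detFormula-distinct₂ x X Z _ = det≡detFormula-[X,Z] x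
  det≡detFormula-distinct₂ x Y Z _ = det≡detFormula-[Y,Z] x
  det≡detFormula-distinct₂ x Y X _ = trans (det-typeMatrix-swap x fzero (pair Y X) (pair-swap Y X)) (det≡detFormula-[X,Y] x)
  det≡detFormula-distinct₂ x Z X _ = trans (det-typeMatrix-swap x fzero (pair Z X) (pair-swap Z X)) (det≡detFormula-[X,Z] x)
  det≡detFormula-distinct₂ x Z Y _ = trans (det-typeMatrix-swap x fzero (pair Z Y) (pair-swap Z Y)) (det≡detFormula-[Y,Z] x)

  det≡detFormula-distinct₃ : ∀ x a b c → a ≢ b → a ≢ c → b ≢ c →
    det (typeMatrix x (triple a b c)) ≡ detFormulaOf x (triple a b c)
  det≡detFormula-distinct₃ x X X c a≢b _ _ = ⊥-elim (a≢b refl)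
  det≡detFormula-distinct₃ x Y Y c a≢b _ _ = ⊥-elim (a≢b refl)
  det≡detFormula-distinct₃ x Z Z c a≢b _ _ = ⊥-elim (a≢b refl)
  det≡detFormula-distinct₃ x X b X _ a≢c _ = ⊥-elim (a≢c refl)
  det≡detFormula-distinct₃ x Y b Y _ a≢c _ = ⊥-elim (a≢c refl)
  det≡detFormula-distinct₃ x Z b Z _ a≢c _ = ⊥-elim (a≢c refl)
  det≡detFormula-distinct₃ x a X X _ _ b≢c = ⊥-elim (b≢c refl)
  det≡detFormula-distinct₃ x a Y Y _ _ b≢c = ⊥-elim (b≢c refl)
  det≡detFormula-distinct₃ x a Z Z _ _ b≢c = ⊥-elim (b≢c refl)
  det≡detFormula-distinct₃ x X Y Z _ _ _ = det≡detFormula-[X,Y,Z] x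
  det≡detFormula-distinct₃ x Y X Z _ _ _ =
    trans (det-typeMatrix-swap x fzero (triple Y X Z) (triple-swap₀₁ Y X Z)) (det≡detFormula-[X,Y,Z] x)
  det≡detFormula-distinct₃ x X Z Y _ _ _ =
    trans (det-typeMatrix-swap x (fsuc fzero) (triple X Z Y) (triple-swap₁₂ X Z Y)) (det≡detFormula-[X,Y,Z] x)
  det≡detFormula-distinct₃ x Y Z X _ _ _ =
    trans (det-typeMatrix-swap x (fsuc fzero) (triple Y Z X) (triple-swap₁₂ Y Z X))
    (trans (det-typeMatrix-swap x fzero (triple Y X Z) (triple-swap₀₁ Y X Z)) (det≡detFormula-[X,Y,Z] x))
  det≡detFormula-distinct₃ x Z X Y _ _ _ =
    trans (det-typeMatrix-swap x fzero (triple Z X Y) (triple-swap₀₁ Z X Y))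
    (trans (det-typeMatrix-swap x (fsuc fzero) (triple X Z Y) (triple-swap₁₂ X Z Y)) (det≡detFormula-[X,Y,Z] x))
  det≡detFormula-distinct₃ x Z Y X _ _ _ =
    trans (det-typeMatrix-swap x fzero (triple Z Y X) (triple-swap₀₁ Z Y X))
    (trans (det-typeMatrix-swap x (fsuc fzero) (triple Y Z X) (triple-swap₁₂ Y Z X))
    (trans (det-typeMatrix-swap x fzero (triple Y X Z) (triple-swap₀₁ Y X Z)) (det≡detFormula-[X,Y,Z] x)))

  Repeated : ∀ {N} → (Fin N → Type) → Set
  Repeated t = ∃₂ λ i j → toℕ i ℕ.< toℕ j × t i ≡ t j

  det≡detFormula-repeated : ∀ {M} x (t : Fin (suc (suc M)) → Type) →
    (∀ (t₁ : Fin (suc M) → Type) → det (typeMatrix x t₁) ≡ detFormulaOf x t₁) →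
    (∀ (t₂ : Fin M → Type) → det (typeMatrix x t₂) ≡ detFormulaOf x t₂) →
    Repeated t → det (typeMatrix x t) ≡ detFormulaOf x t
  det≡detFormula-repeated x t ih₁ ih₂ (i , j , i<j , tᵢ≡tⱼ) with t′ , r , t′₀≡t′₁ ← pairInFront (toℕ i) t i j refl i<j tᵢ≡tⱼ =
    trans (det-typeMatrix-reorder x r)
    (trans (det≡detFormula-step x t′ t′₀≡t′₁ (ih₁ (λ i → t′ (fsuc i))) (ih₂ (λ i → t′ (fsuc (fsuc i)))))
           (sym (detFormulaOf-reorder x r)))

  det≡detFormula-size₂ : ∀ x (t : Fin 2 → Type) → det (typeMatrix x t) ≡ detFormulaOf x t
  det≡detFormula-size₂ x t = by-cases (t fzero ≟ t (fsuc fzero))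
    where
    by-cases : Dec (t fzero ≡ t (fsuc fzero)) → det (typeMatrix x t) ≡ detFormulaOf x t
    by-cases (yes t₀≡t₁) =
      det≡detFormula-repeated x t (det≡detFormula-single x) (λ _ → refl) (fzero , fsuc fzero , s≤s z≤n , t₀≡t₁)
    by-cases (no t₀≢t₁) =
      trans (det-typeMatrix-retype x t (pair (t fzero) (t (fsuc fzero))) λ { fzero → refl ; (fsuc fzero) → refl })
            (det≡detFormula-distinct₂ x (t fzero) (t (fsuc fzero)) t₀≢t₁)

  det≡detFormula-size₃ : ∀ x (t : Fin 3 → Type) → det (typeMatrix x t) ≡ detFormulaOf x t
  det≡detFormula-size₃ x t =
    by-cases (t fzero ≟ t (fsuc fzero)) (t fzero ≟ t (fsuc (fsuc fzero))) (t (fsuc fzero) ≟ t (fsuc (fsuc fzero)))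
    where
    fromRepeat : Repeated t → det (typeMatrix x t) ≡ detFormulaOf x t
    fromRepeat = det≡detFormula-repeated x t (det≡detFormula-size₂ x) (det≡detFormula-single x)
    by-cases : Dec (t fzero ≡ t (fsuc fzero)) → Dec (t fzero ≡ t (fsuc (fsuc fzero))) →
      Dec (t (fsuc fzero) ≡ t (fsuc (fsuc fzero))) → det (typeMatrix x t) ≡ detFormulaOf x t
    by-cases (yes t₀≡t₁) _ _ = fromRepeat (fzero , fsuc fzero , s≤s z≤n , t₀≡t₁)
    by-cases (no _) (yes t₀≡t₂) _ = fromRepeat (fzero , fsuc (fsuc fzero) , s≤s z≤n , t₀≡t₂)
    by-cases (no _) (no _) (yes t₁≡t₂) = fromRepeat (fsuc fzero , fsuc (fsuc fzero) , s≤s (s≤s z≤n) , t₁≡t₂)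
    by-cases (no t₀≢t₁) (no t₀≢t₂) (no t₁≢t₂) =
      trans (det-typeMatrix-retype x t (triple (t fzero) (t (fsuc fzero)) (t (fsuc (fsuc fzero))))
              λ { fzero → refl ; (fsuc fzero) → refl ; (fsuc (fsuc fzero)) → refl })
            (det≡detFormula-distinct₃ x (t fzero) (t (fsuc fzero)) (t (fsuc (fsuc fzero))) t₀≢t₁ t₀≢t₂ t₁≢t₂)

  -- From size four on, some type is repeated by pigeonhole.
  det≡detFormula : ∀ N x (t : Fin N → Type) → det (typeMatrix x t) ≡ detFormulaOf x t
  det≡detFormula zero                   x t = refl
  det≡detFormula (suc zero)             x t = det≡detFormula-single x t
  det≡detFormula (suc (suc zero))       x t = det≡detFormula-size₂ x t
  det≡detFormula (suc (suc (suc zero))) x t = det≡detFormula-size₃ x t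
  det≡detFormula (suc (suc (suc (suc N)))) x t =
    det≡detFormula-repeated x t (det≡detFormula (suc (suc (suc N))) x) (det≡detFormula (suc (suc N)) x)
      (pigeonhole (s≤s (s≤s (s≤s (s≤s z≤n)))) t)

module CharPoly where
  open import Defs
  open TypeMatrix using (pow′; blockFormula; blockFormula-linear₁; detFormula)
  open import Data.Nat as ℕ using (ℕ; zero; suc; _∸_)
  import Data.Nat.Properties as ℕ
  open import Data.Integer using (ℤ; +_; -_; _+_; _*_)
  import Data.Integer.Properties as ℤ
  open import Data.Integer.Tactic.RingSolver using (solve-∀)
  open import Relation.Binary.PropositionalEquality

  ^ᶻ-distribˡ-+ : ∀ x m n → x ^ᶻ (m ℕ.+ n) ≡ x ^ᶻ m * x ^ᶻ n
  ^ᶻ-distribˡ-+ x zero    n = sym (ℤ.*-identityˡ (x ^ᶻ n))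
  ^ᶻ-distribˡ-+ x (suc m) n = trans (cong (x *_) (^ᶻ-distribˡ-+ x m n)) (sym (ℤ.*-assoc x (x ^ᶻ m) (x ^ᶻ n)))

  pow′-suc : ∀ d n → pow′ d (suc n) ≡ + suc n * d ^ᶻ n
  pow′-suc d zero = by-ring d
    where
    by-ring : ∀ d → + 1 + d * + 0 ≡ + 1 * + 1
    by-ring = solve-∀
  pow′-suc d (suc n) =
    trans (cong (λ z → d * d ^ᶻ n + d * z) (pow′-suc d n))
          (trans (by-ring d (d ^ᶻ n) (+ suc n)) (cong (_* (d * d ^ᶻ n)) (sym (ℤ.pos-+ 1 (suc n)))))
    where
    by-ring : ∀ d p m → d * p + d * (m * p) ≡ (+ 1 + m) * (d * p)
    by-ring = solve-∀

  *-pow′ : ∀ d a → d * pow′ d a ≡ + a * d ^ᶻ a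
  *-pow′ d zero = by-ring d
    where
    by-ring : ∀ d → d * + 0 ≡ + 0 * + 1
    by-ring = solve-∀
  *-pow′ d (suc a) = trans (cong (d *_) (pow′-suc d a)) (by-ring d (+ suc a) (d ^ᶻ a))
    where
    by-ring : ∀ d m p → d * (m * p) ≡ m * (d * p)
    by-ring = solve-∀

  -- Pcub with the integer constants + (m₁ * m₂) and + (m₁ + m₂) split into their factors.
  cubic : ℤ → ℤ → ℤ → ℤ
  cubic x C B = x * (x * (x * + 1)) + (+ 2 + - (C * B)) * (x * (x * + 1)) + ((+ 1 + - (C * B)) * (C + B) + - (C * B)) * x + - ((C * B) * (C * B))

  Pcub≡cubic : ∀ m₁ m₂ x → Pcub m₁ m₂ x ≡ cubic x (+ m₁) (+ m₂)
  Pcub≡cubic m₁ m₂ x = cong₂ (λ a s → x ^ᶻ 3 + (+ 2 + - a) * x ^ᶻ 2 + ((+ 1 + - a) * s + - a) * x + - (a * a))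
                             (ℤ.pos-* m₁ m₂) (ℤ.pos-+ m₁ m₂)

  -- Type Y and Z vertices have diagonal entry x, so their pairs become (x ^ (b + 1), (b + 1) x ^ b).
  detFormula-suc-suc : ∀ x a b c → detFormula x a (suc b) (suc c)
    ≡ blockFormula ((x + + 1) ^ᶻ a) (pow′ (x + + 1) a) (x * x ^ᶻ b) (+ suc b * x ^ᶻ b) (x * x ^ᶻ c) (+ suc c * x ^ᶻ c)
  detFormula-suc-suc x a b c =
    trans (cong (λ y → blockFormula ((x + + 1) ^ᶻ a) (pow′ (x + + 1) a) (y * y ^ᶻ b) (pow′ y (suc b)) (y * y ^ᶻ c) (pow′ y (suc c)))
                (ℤ.+-identityʳ x))
          (cong₂ (λ B₁ C₁ → blockFormula ((x + + 1) ^ᶻ a) (pow′ (x + + 1) a) (x * x ^ᶻ b) B₁ (x * x ^ᶻ c) C₁)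
                 (pow′-suc x b) (pow′-suc x c))

  count-as-ℤ : ∀ a b c → suc a ≡ suc c ℕ.* suc b → + a ≡ + suc c * + suc b + - + 1
  count-as-ℤ a b c a+1≡ = trans (by-ring (+ a))
    (cong (_+ - + 1) (trans (sym (ℤ.pos-+ 1 a)) (trans (cong +_ a+1≡) (ℤ.pos-* (suc c) (suc b)))))
    where
    by-ring : ∀ y → y ≡ (+ 1 + y) + - + 1
    by-ring = solve-∀

  x^[c+b] : ∀ x b c → x ^ᶻ (suc c ℕ.+ suc b ∸ 2) ≡ x ^ᶻ c * x ^ᶻ b
  x^[c+b] x b c = trans (cong (λ z → x ^ᶻ (z ∸ 1)) (ℕ.+-suc c b)) (^ᶻ-distribˡ-+ x c b)

  -- With a + 1 = m₁ m₂ vertices of type X, b + 1 = m₂ of type Y and c + 1 = m₁ of type Z.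
  detFormula*[x+1]² : ∀ x a b c → suc a ≡ suc c ℕ.* suc b →
    detFormula x a (suc b) (suc c) * (x + + 1) ^ᶻ 2
    ≡ x ^ᶻ (suc c ℕ.+ suc b ∸ 2) * (x + + 1) ^ᶻ (suc c ℕ.* suc b) * Pcub (suc c) (suc b) x
  detFormula*[x+1]² x a b c a+1≡ = begin
    detFormula x a (suc b) (suc c) * (e * (e * + 1))
      ≡⟨ cong (_* (e * (e * + 1))) (trans (detFormula-suc-suc x a b c) (blockFormula-linear₁ E A₁ (x * xᵇ) (B * xᵇ) (x * xᶜ) (C * xᶜ))) ⟩
    (E * α + A₁ * β) * (e * (e * + 1))
      ≡⟨ regroup e E A₁ α β ⟩
    e * (e * E * α + (e * A₁) * β)
      ≡⟨ cong (λ z → e * (e * E * α + z * β)) (trans (*-pow′ e a) (cong (_* E) (count-as-ℤ a b c a+1≡))) ⟩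
    e * (e * E * α + ((C * B + - + 1) * E) * β)
      ≡⟨ factorise x E xᵇ xᶜ B C ⟩
    (xᶜ * xᵇ) * (e * E) * cubic x C B
      ≡⟨ cong₂ (λ u w → u * w * cubic x C B) (sym (x^[c+b] x b c)) (cong (e ^ᶻ_) a+1≡) ⟩
    x ^ᶻ (suc c ℕ.+ suc b ∸ 2) * e ^ᶻ (suc c ℕ.* suc b) * cubic x C B
      ≡⟨ cong (x ^ᶻ (suc c ℕ.+ suc b ∸ 2) * e ^ᶻ (suc c ℕ.* suc b) *_) (Pcub≡cubic (suc c) (suc b) x) ⟨
    x ^ᶻ (suc c ℕ.+ suc b ∸ 2) * e ^ᶻ (suc c ℕ.* suc b) * Pcub (suc c) (suc b) x ∎
    where
    open ≡-Reasoning
    e = x + + 1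
    E = e ^ᶻ a
    A₁ = pow′ e a
    xᵇ = x ^ᶻ b
    xᶜ = x ^ᶻ c
    B = + suc b
    C = + suc c
    α = x * xᵇ * (x * xᶜ) + - (B * xᵇ * (C * xᶜ))
    β = - (x * xᵇ * (x * xᶜ) + B * xᵇ * (x * xᶜ) + x * xᵇ * (C * xᶜ) + B * xᵇ * (C * xᶜ))
    regroup : ∀ e E A₁ α β → (E * α + A₁ * β) * (e * (e * + 1)) ≡ e * (e * E * α + (e * A₁) * β)
    regroup = solve-∀
    factorise : ∀ x E xᵇ xᶜ B C →
      (x + + 1) * ((x + + 1) * E * (x * xᵇ * (x * xᶜ) + - (B * xᵇ * (C * xᶜ)))
        + ((C * B + - + 1) * E) * - (x * xᵇ * (x * xᶜ) + B * xᵇ * (x * xᶜ) + x * xᵇ * (C * xᶜ) + B * xᵇ * (C * xᶜ)))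
      ≡ (xᶜ * xᵇ) * ((x + + 1) * E) * (x * (x * (x * + 1)) + (+ 2 + - (C * B)) * (x * (x * + 1)) + ((+ 1 + - (C * B)) * (C + B) + - (C * B)) * x + - ((C * B) * (C * B)))
    factorise = solve-∀

  detFormula≡ : ∀ x a b c → suc (suc a) ≡ suc c ℕ.* suc b →
    detFormula x (suc a) (suc b) (suc c) ≡ x ^ᶻ (suc c ℕ.+ suc b ∸ 2) * (x + + 1) ^ᶻ (suc c ℕ.* suc b ∸ 2) * Pcub (suc c) (suc b) x
  detFormula≡ x a b c a+2≡ = begin
    detFormula x (suc a) (suc b) (suc c)
      ≡⟨ trans (detFormula-suc-suc x (suc a) b c) (blockFormula-linear₁ (e * E) (pow′ e (suc a)) (x * xᵇ) (B * xᵇ) (x * xᶜ) (C * xᶜ)) ⟩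
    e * E * α + pow′ e (suc a) * β
      ≡⟨ cong (λ z → e * E * α + z * β) (trans (pow′-suc e a) (cong (_* E) (count-as-ℤ (suc a) b c a+2≡))) ⟩
    e * E * α + ((C * B + - + 1) * E) * β
      ≡⟨ factorise x E xᵇ xᶜ B C ⟩
    (xᶜ * xᵇ) * E * cubic x C B
      ≡⟨ cong₂ (λ u w → u * w * cubic x C B) (sym (x^[c+b] x b c)) (cong (λ z → e ^ᶻ (z ∸ 2)) a+2≡) ⟩
    x ^ᶻ (suc c ℕ.+ suc b ∸ 2) * e ^ᶻ (suc c ℕ.* suc b ∸ 2) * cubic x C B
      ≡⟨ cong (x ^ᶻ (suc c ℕ.+ suc b ∸ 2) * e ^ᶻ (suc c ℕ.* suc b ∸ 2) *_) (Pcub≡cubic (suc c) (suc b) x) ⟨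
    x ^ᶻ (suc c ℕ.+ suc b ∸ 2) * e ^ᶻ (suc c ℕ.* suc b ∸ 2) * Pcub (suc c) (suc b) x ∎
    where
    open ≡-Reasoning
    e = x + + 1
    E = e ^ᶻ a
    xᵇ = x ^ᶻ b
    xᶜ = x ^ᶻ c
    B = + suc b
    C = + suc c
    α = x * xᵇ * (x * xᶜ) + - (B * xᵇ * (C * xᶜ))
    β = - (x * xᵇ * (x * xᶜ) + B * xᵇ * (x * xᶜ) + x * xᵇ * (C * xᶜ) + B * xᵇ * (C * xᶜ))
    factorise : ∀ x E xᵇ xᶜ B C →
      (x + + 1) * E * (x * xᵇ * (x * xᶜ) + - (B * xᵇ * (C * xᶜ)))
        + ((C * B + - + 1) * E) * - (x * xᵇ * (x * xᶜ) + B * xᵇ * (x * xᶜ) + x * xᵇ * (C * xᶜ) + B * xᵇ * (C * xᶜ))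
      ≡ (xᶜ * xᵇ) * E * (x * (x * (x * + 1)) + (+ 2 + - (C * B)) * (x * (x * + 1)) + ((+ 1 + - (C * B)) * (C + B) + - (C * B)) * x + - ((C * B) * (C * B)))
    factorise = solve-∀

module Counting where
  open TypeMatrix using (Type; X; Y; Z; indicator; count)
  open import Data.Nat as ℕ using (ℕ; zero; suc)
  open import Data.Fin using (Fin; punchIn; punchOut) renaming (zero to fzero; suc to fsuc)
  open import Data.Fin.Properties using (_≟_; punchIn-injective; punchInᵢ≢i; punchIn-punchOut; suc-injective)
  open import Data.Product using (∃; _,_)
  open import Function.Definitions using (Injective)
  open import Relation.Binary.PropositionalEquality
  open import Relation.Nullary using (yes; no)

  indicator-refl : ∀ T → indicator T T ≡ 1
  indicator-refl X = refl
  indicator-refl Y = refl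
  indicator-refl Z = refl

  indicator-≢ : ∀ {T U} → T ≢ U → indicator T U ≡ 0
  indicator-≢ {X} {X} T≢U with () ← T≢U refl
  indicator-≢ {X} {Y} T≢U = refl
  indicator-≢ {X} {Z} T≢U = refl
  indicator-≢ {Y} {X} T≢U = refl
  indicator-≢ {Y} {Y} T≢U with () ← T≢U refl
  indicator-≢ {Y} {Z} T≢U = refl
  indicator-≢ {Z} {X} T≢U = refl
  indicator-≢ {Z} {Y} T≢U = refl
  indicator-≢ {Z} {Z} T≢U with () ← T≢U refl

  count-enumeration : ∀ {N m} (t : Fin N → Type) U (f : Fin m → Fin N) → Injective _≡_ _≡_ f →
    (∀ k → t (f k) ≡ U) → (∀ i → t i ≡ U → ∃ λ k → f k ≡ i) → count t U ≡ m
  count-enumeration {zero} {zero}  t U f f-inj f-typed f-onto = refl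
  count-enumeration {zero} {suc m} t U f f-inj f-typed f-onto with () ← f fzero
  count-enumeration {suc N} {m} t U f f-inj f-typed f-onto with t fzero ≟ U
  ... | no t₀≢U = trans (cong (ℕ._+ count t′ U) (indicator-≢ t₀≢U)) (count-enumeration t′ U f′ f′-inj f′-typed f′-onto)
    where
    t′ = λ i → t (fsuc i)
    0≢f : ∀ k → fzero ≢ f k
    0≢f k 0≡fk = t₀≢U (trans (cong t 0≡fk) (f-typed k))
    f′ : Fin m → Fin N
    f′ k = punchOut (0≢f k)
    f′-inj : Injective _≡_ _≡_ f′
    f′-inj {a} {b} eq = f-inj (trans (sym (punchIn-punchOut (0≢f a))) (trans (cong fsuc eq) (punchIn-punchOut (0≢f b))))
    f′-typed : ∀ k → t′ (f′ k) ≡ U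
    f′-typed k = trans (cong t (punchIn-punchOut (0≢f k))) (f-typed k)
    f′-onto : ∀ i → t′ i ≡ U → ∃ λ k → f′ k ≡ i
    f′-onto i tᵢ≡U with k , fk≡i+1 ← f-onto (fsuc i) tᵢ≡U = k , suc-injective (trans (punchIn-punchOut (0≢f k)) fk≡i+1)
  ... | yes t₀≡U with k₀ , fk₀≡0 ← f-onto fzero t₀≡U = without-k₀ f f-inj f-typed f-onto k₀ fk₀≡0
    where
    t′ = λ i → t (fsuc i)
    -- The index 0 is enumerated at k₀; the others are enumerated by f ∘ punchIn k₀.
    without-k₀ : ∀ {m} (f : Fin m → Fin (suc N)) → Injective _≡_ _≡_ f → (∀ k → t (f k) ≡ U) →
      (∀ i → t i ≡ U → ∃ λ k → f k ≡ i) → (k₀ : Fin m) → f k₀ ≡ fzero → indicator (t fzero) U ℕ.+ count t′ U ≡ m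
    without-k₀ {suc m′} f f-inj f-typed f-onto k₀ fk₀≡0 =
      trans (cong (ℕ._+ count t′ U) (trans (cong (λ T → indicator T U) t₀≡U) (indicator-refl U)))
            (cong suc (count-enumeration t′ U f′ f′-inj f′-typed f′-onto))
      where
      0≢f : ∀ k → fzero ≢ f (punchIn k₀ k)
      0≢f k 0≡f = punchInᵢ≢i k₀ k (f-inj (trans (sym 0≡f) (sym fk₀≡0)))
      f′ : Fin m′ → Fin N
      f′ k = punchOut (0≢f k)
      f′-inj : Injective _≡_ _≡_ f′
      f′-inj {a} {b} eq = punchIn-injective k₀ a b
        (f-inj (trans (sym (punchIn-punchOut (0≢f a))) (trans (cong fsuc eq) (punchIn-punchOut (0≢f b)))))
      f′-typed : ∀ k → t′ (f′ k) ≡ U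
      f′-typed k = trans (cong t (punchIn-punchOut (0≢f k))) (f-typed (punchIn k₀ k))
      f′-onto : ∀ i → t′ i ≡ U → ∃ λ k → f′ k ≡ i
      f′-onto i tᵢ≡U with k , fk≡i+1 ← f-onto (fsuc i) tᵢ≡U = punchOut k₀≢k , suc-injective
        (trans (punchIn-punchOut (0≢f (punchOut k₀≢k))) (trans (cong f (punchIn-punchOut k₀≢k)) fk≡i+1))
        where
        k₀≢k : k₀ ≢ k
        k₀≢k k₀≡k with () ← trans (sym fk₀≡0) (trans (cong f k₀≡k) fk≡i+1)

module PrimePowers where
  open import Data.Nat
  open import Data.Nat.Properties
  open import Data.Nat.Divisibility
  open import Data.Nat.Primality
  open import Data.Nat.Coprimality using (coprime-divisor)
  open import Data.Empty using (⊥-elim)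
  open import Data.Product using (∃; ∃₂; _×_; _,_)
  open import Data.Sum using (inj₁; inj₂)
  open import Relation.Binary.PropositionalEquality
  open import Relation.Nullary using (yes; no; ¬_)

  prime>1 : ∀ {p} → Prime p → 1 < p
  prime>1 {p} p-prime = nonTrivial⇒n>1 p {{prime⇒nonTrivial p-prime}}

  prime∤1 : ∀ {p} → Prime p → ¬ p ∣ 1
  prime∤1 p-prime p∣1 = <-irrefl (sym (∣1⇒≡1 p∣1)) (prime>1 p-prime)

  prime∤prime^ : ∀ {p q} → Prime p → Prime q → p ≢ q → ∀ b → ¬ p ∣ q ^ b
  prime∤prime^ p-prime q-prime p≢q zero    p∣1 = prime∤1 p-prime p∣1
  prime∤prime^ p-prime q-prime p≢q (suc b) p∣q^b+1 with euclidsLemma _ (_ ^ b) p-prime p∣q^b+1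
  ... | inj₂ p∣q^b = prime∤prime^ p-prime q-prime p≢q b p∣q^b
  ... | inj₁ p∣q with prime⇒irreducible q-prime p∣q
  ...   | inj₁ refl = prime∤1 p-prime ∣-refl
  ...   | inj₂ p≡q = p≢q p≡q

  prime^∣*-cancelʳ : ∀ {p h} → Prime p → ¬ p ∣ h → ∀ m g → p ^ m ∣ g * h → p ^ m ∣ g
  prime^∣*-cancelʳ p-prime p∤h zero    g _ = 1∣ g
  prime^∣*-cancelʳ {p} {h} p-prime p∤h (suc m) g p^m+1∣gh with euclidsLemma g h p-prime (∣-trans (m∣m*n (p ^ m)) p^m+1∣gh)
  ... | inj₂ p∣h = ⊥-elim (p∤h p∣h)
  ... | inj₁ (divides c refl) = subst (p * p ^ m ∣_) (*-comm p c) (*-monoʳ-∣ p p^m∣c)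
    where
    instance _ = prime⇒nonZero p-prime
    p^m∣c : p ^ m ∣ c
    p^m∣c = prime^∣*-cancelʳ p-prime p∤h m c
      (*-cancelˡ-∣ p (subst (p * p ^ m ∣_) (trans (cong (_* h) (*-comm c p)) (*-assoc p c h)) p^m+1∣gh))

  ∤prime⇒∣prime*⇒∣ : ∀ {p d x} → Prime p → ¬ p ∣ d → d ∣ p * x → d ∣ x
  ∤prime⇒∣prime*⇒∣ p-prime p∤d = coprime-divisor coprime
    where
    coprime : ∀ {c} → c ∣ _ × c ∣ _ → c ≡ 1
    coprime (c∣d , c∣p) with prime⇒irreducible p-prime c∣p
    ... | inj₁ c≡1 = c≡1
    ... | inj₂ refl = ⊥-elim (p∤d c∣d)

  ^-monoʳ-∣ : ∀ p {a b} → a ≤ b → p ^ a ∣ p ^ b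
  ^-monoʳ-∣ p {a} {b} a≤b = divides (p ^ (b ∸ a)) (begin
    p ^ b             ≡⟨ cong (p ^_) (m+[n∸m]≡n a≤b) ⟨
    p ^ (a + (b ∸ a)) ≡⟨ ^-distribˡ-+-* p a (b ∸ a) ⟩
    p ^ a * p ^ (b ∸ a) ≡⟨ *-comm (p ^ a) _ ⟩
    p ^ (b ∸ a) * p ^ a ∎)
    where open ≡-Reasoning

  divisor-of-prime^ : ∀ {q} → Prime q → ∀ b d → d ∣ q ^ b → ∃ λ β → β ≤ b × d ≡ q ^ β
  divisor-of-prime^ q-prime zero d d∣1 = 0 , z≤n , ∣1⇒≡1 d∣1
  divisor-of-prime^ {q} q-prime (suc b) d d∣q^b+1 with q ∣? d
  ... | no q∤d with β , β≤b , d≡q^β ← divisor-of-prime^ q-prime b d (∤prime⇒∣prime*⇒∣ q-prime q∤d d∣q^b+1) =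
    β , m≤n⇒m≤1+n β≤b , d≡q^β
  ... | yes (divides c refl)
    with β , β≤b , refl ← divisor-of-prime^ q-prime b c
           (*-cancelˡ-∣ q {{prime⇒nonZero q-prime}} (subst (_∣ q * q ^ b) (*-comm c q) d∣q^b+1)) =
    suc β , s≤s β≤b , *-comm (q ^ β) q

  divisor-of-prime^*prime^ : ∀ {p q} → Prime p → Prime q → ∀ a b d → d ∣ p ^ a * q ^ b →
    ∃₂ λ α β → α ≤ a × β ≤ b × d ≡ p ^ α * q ^ β
  divisor-of-prime^*prime^ {p} {q} p-prime q-prime zero b d d∣q^b
    with β , β≤b , d≡q^β ← divisor-of-prime^ q-prime b d (subst (d ∣_) (*-identityˡ (q ^ b)) d∣q^b) =
    0 , β , z≤n , β≤b , trans d≡q^β (sym (*-identityˡ (q ^ β)))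
  divisor-of-prime^*prime^ {p} {q} p-prime q-prime (suc a) b d d∣n with p ∣? d
  ... | no p∤d
    with α , β , α≤a , β≤b , d≡ ← divisor-of-prime^*prime^ p-prime q-prime a b d
                                    (∤prime⇒∣prime*⇒∣ p-prime p∤d (subst (d ∣_) (*-assoc p (p ^ a) (q ^ b)) d∣n)) =
    α , β , m≤n⇒m≤1+n α≤a , β≤b , d≡
  ... | yes (divides c refl)
    with α , β , α≤a , β≤b , refl ← divisor-of-prime^*prime^ p-prime q-prime a b c
           (*-cancelˡ-∣ p {{prime⇒nonZero p-prime}}
             (subst (_∣ p * (p ^ a * q ^ b)) (*-comm c p) (subst (c * p ∣_) (*-assoc p (p ^ a) (q ^ b)) d∣n))) =
    suc α , β , s≤s α≤a , β≤b , trans (*-comm (p ^ α * q ^ β) p) (sym (*-assoc p (p ^ α) (q ^ β)))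

  prime^*prime^-∣⇒≤ : ∀ {p q} → Prime p → Prime q → p ≢ q → ∀ α β α′ β′ → p ^ α * q ^ β ∣ p ^ α′ * q ^ β′ → α ≤ α′
  prime^*prime^-∣⇒≤ {p} {q} p-prime q-prime p≢q α β α′ β′ divides-n with α ≤? α′
  ... | yes α≤α′ = α≤α′
  ... | no α≰α′ = ⊥-elim (prime∤prime^ p-prime q-prime p≢q β′ (*-cancelˡ-∣ (p ^ α′) p^α′*p∣))
    where
    instance _ = m^n≢0 p α′ {{prime⇒nonZero p-prime}}
    p^α′*p∣ : p ^ α′ * p ∣ p ^ α′ * q ^ β′
    p^α′*p∣ = subst (_∣ p ^ α′ * q ^ β′) (*-comm p (p ^ α′))
                    (∣-trans (^-monoʳ-∣ p (≰⇒> α≰α′)) (∣-trans (m∣m*n (q ^ β)) divides-n))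

module Ideals (k : ℕ) where
  open import Defs
  open import Data.Nat as ℕ using (zero; suc; _+_; _*_; _∸_; _%_; _/_; _≤_; _<_; NonZero; _≟_)
  import Data.Nat.Properties as ℕ
  open import Data.Nat.DivMod
  open import Data.Nat.Divisibility
  open import Data.Fin using (Fin; toℕ; fromℕ<; Fin′; inject) renaming (zero to fzero)
  open import Data.Fin.Properties using (toℕ-injective; toℕ-fromℕ<; toℕ<n; toℕ-inject; ¬∀⟶∃¬-smallest)
  open import Data.Fin.Subset using (Subset; _∈_)
  open import Data.Fin.Subset.Properties using (_∈?_; ⊆-antisym)
  open import Data.Vec using (tabulate)
  open import Data.Vec.Properties using ([]=⇒lookup; lookup⇒[]=; lookup∘tabulate)
  open import Data.Bool using (true)
  open import Data.Empty using (⊥-elim)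
  open import Data.Product using (∃; _×_; _,_; proj₁; proj₂)
  open import Data.Sum using (_⊎_; inj₁; inj₂)
  open import Relation.Binary.PropositionalEquality
  open import Relation.Nullary using (yes; no; ¬_; Dec; does)
  open import Relation.Nullary.Decidable using (_×-dec_; ¬?)

  private
    n : ℕ
    n = suc k

  toℕ-mod : ∀ m → toℕ (m mod n) ≡ m % n
  toℕ-mod m = toℕ-fromℕ< _

  toℕ-⊕ : ∀ (a b : Fin n) → toℕ (a ⊕ b) ≡ (toℕ a + toℕ b) % n
  toℕ-⊕ a b = toℕ-mod (toℕ a + toℕ b)

  toℕ-⊖ : ∀ (a b : Fin n) → toℕ (a ⊖ b) ≡ (toℕ a + (n ∸ toℕ b)) % n
  toℕ-⊖ a b = toℕ-mod (toℕ a + (n ∸ toℕ b))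

  toℕ-⊗ : ∀ (a b : Fin n) → toℕ (a ⊗ b) ≡ (toℕ a * toℕ b) % n
  toℕ-⊗ a b = toℕ-mod (toℕ a * toℕ b)

  [a+[n∸b]]%n≡a∸b : ∀ a b → b ≤ a → a < n → (a + (n ∸ b)) % n ≡ a ∸ b
  [a+[n∸b]]%n≡a∸b a b b≤a a<n = begin
    (a + (n ∸ b)) % n   ≡⟨ cong (_% n) regroup ⟩
    (a ∸ b + n) % n     ≡⟨ %-remove-+ʳ (a ∸ b) (∣-refl {n}) ⟩
    (a ∸ b) % n         ≡⟨ m<n⇒m%n≡m (ℕ.≤-<-trans (ℕ.m∸n≤m a b) a<n) ⟩
    a ∸ b               ∎
    where
    open ≡-Reasoning
    regroup : a + (n ∸ b) ≡ a ∸ b + n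
    regroup = begin
      a + (n ∸ b)         ≡⟨ cong (_+ (n ∸ b)) (ℕ.m∸n+n≡m b≤a) ⟨
      a ∸ b + b + (n ∸ b) ≡⟨ ℕ.+-assoc (a ∸ b) b (n ∸ b) ⟩
      a ∸ b + (b + (n ∸ b)) ≡⟨ cong (a ∸ b +_) (ℕ.m+[n∸m]≡n (ℕ.≤-trans b≤a (ℕ.<⇒≤ a<n))) ⟩
      a ∸ b + n           ∎

  module _ {I : Subset n} (I-ideal : IsIdeal I) where

    private
      ⊖-closed = proj₁ (proj₂ I-ideal)
      ⊗-closed = proj₂ (proj₂ I-ideal)

    0∈ideal : fzero ∈ I
    0∈ideal with a , a∈I ← proj₁ I-ideal =
      subst (_∈ I) (toℕ-injective (trans (toℕ-⊖ a a) (trans ([a+[n∸b]]%n≡a∸b (toℕ a) (toℕ a) ℕ.≤-refl (toℕ<n a))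
                                                            (ℕ.n∸n≡0 (toℕ a)))))
            (⊖-closed a a a∈I a∈I)

    ideal-*-closed : ∀ {y} → y ∈ I → ∀ c → c * toℕ y < n → ∃ λ z → z ∈ I × toℕ z ≡ c * toℕ y
    ideal-*-closed {y} y∈I c cy<n = (c mod n) ⊗ y , ⊗-closed (c mod n) y y∈I , (begin
      toℕ ((c mod n) ⊗ y)               ≡⟨ toℕ-⊗ (c mod n) y ⟩
      (toℕ (c mod n) * toℕ y) % n       ≡⟨ cong (λ z → (z * toℕ y) % n) (toℕ-mod c) ⟩
      ((c % n) * toℕ y) % n             ≡⟨ cong (λ z → ((c % n) * z) % n) (m<n⇒m%n≡m (toℕ<n y)) ⟨
      ((c % n) * (toℕ y % n)) % n       ≡⟨ %-distribˡ-* c (toℕ y) n ⟨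
      (c * toℕ y) % n                   ≡⟨ m<n⇒m%n≡m cy<n ⟩
      c * toℕ y                         ∎)
      where open ≡-Reasoning

    ideal-∸-closed : ∀ {x y} → x ∈ I → y ∈ I → toℕ y ≤ toℕ x → ∃ λ z → z ∈ I × toℕ z ≡ toℕ x ∸ toℕ y
    ideal-∸-closed {x} {y} x∈I y∈I y≤x =
      x ⊖ y , ⊖-closed x y x∈I y∈I , trans (toℕ-⊖ x y) ([a+[n∸b]]%n≡a∸b (toℕ x) (toℕ y) y≤x (toℕ<n x))

    record LeastNonzero : Set where
      field
        g        : Fin n
        g∈I      : g ∈ I
        g≢0      : toℕ g ≢ 0
        g-least  : ∀ y → toℕ y < toℕ g → y ∈ I → toℕ y ≡ 0

    leastNonzero : NonzeroSet I → LeastNonzero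
    leastNonzero (a , a∈I , a≢0) with ¬∀⟶∃¬-smallest n Bad Bad? (λ all-bad → all-bad a (a∈I , a≢0))
      where
      Bad : Fin n → Set
      Bad x = ¬ (x ∈ I × toℕ x ≢ 0)
      Bad? : ∀ x → Dec (Bad x)
      Bad? x = ¬? ((x ∈? I) ×-dec ¬? (toℕ x ≟ 0))
    ... | g , ¬¬g , smallest = record { g = g ; g∈I = proj₁ g-good ; g≢0 = proj₂ g-good ; g-least = least }
      where
      g-good : g ∈ I × toℕ g ≢ 0
      g-good with g ∈? I | toℕ g ≟ 0
      ... | yes g∈I | no g≢0  = g∈I , g≢0
      ... | no g∉I  | _       = ⊥-elim (¬¬g (λ good → g∉I (proj₁ good)))
      ... | yes _   | yes g≡0 = ⊥-elim (¬¬g (λ good → proj₂ good g≡0))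
      least : ∀ y → toℕ y < toℕ g → y ∈ I → toℕ y ≡ 0
      least y y<g y∈I with toℕ y ≟ 0
      ... | yes y≡0 = y≡0
      ... | no y≢0 = ⊥-elim (smallest j (subst (_∈ I) (sym inject-j≡y) y∈I , subst (λ z → toℕ z ≢ 0) (sym inject-j≡y) y≢0))
        where
        j : Fin′ g
        j = fromℕ< y<g
        inject-j≡y : inject j ≡ y
        inject-j≡y = toℕ-injective (trans (toℕ-inject j) (toℕ-fromℕ< y<g))

    module _ (L : LeastNonzero) where
      open LeastNonzero L

      private
        G : ℕ
        G = toℕ g
        instance
          G≢0 : NonZero G
          G≢0 = ℕ.≢-nonZero g≢0

      -- The remainder of x modulo g lies in I and is smaller than g, hence vanishes.
      least∣member : ∀ x → x ∈ I → G ∣ toℕ x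
      least∣member x x∈I = m%n≡0⇒n∣m (toℕ x) G (trans (sym r≡x%G) (g-least r r<G r∈I))
        where
        q*G≤x : toℕ x / G * G ≤ toℕ x
        q*G≤x = m/n*n≤m (toℕ x) G
        qg = ideal-*-closed g∈I (toℕ x / G) (ℕ.≤-<-trans q*G≤x (toℕ<n x))
        rest = ideal-∸-closed x∈I (proj₁ (proj₂ qg)) (subst (_≤ toℕ x) (sym (proj₂ (proj₂ qg))) q*G≤x)
        r = proj₁ rest
        r∈I = proj₁ (proj₂ rest)
        r≡x%G : toℕ r ≡ toℕ x % G
        r≡x%G = trans (proj₂ (proj₂ rest)) (trans (cong (toℕ x ∸_) (proj₂ (proj₂ qg))) (sym (m%n≡m∸m/n*n (toℕ x) G)))
        r<G : toℕ r < G
        r<G = subst (_< G) (sym r≡x%G) (m%n<n (toℕ x) G)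

      ∣least⇒member : ∀ x → G ∣ toℕ x → x ∈ I
      ∣least⇒member x (divides c x≡cG) with z , z∈I , z≡cG ← ideal-*-closed g∈I c (subst (_< n) x≡cG (toℕ<n x)) =
        subst (_∈ I) (toℕ-injective (trans z≡cG (sym x≡cG))) z∈I

      -- Likewise 0 - (n / g) g ≡ n % g lies in I.
      least∣n : G ∣ n
      least∣n with n % G ≟ 0
      ... | yes n%G≡0 = m%n≡0⇒n∣m n G n%G≡0
      ... | no n%G≢0 = ⊥-elim (n%G≢0 (trans (sym r≡n%G) (g-least r r<G r∈I)))
        where
        c = n / G
        cG≤n : c * G ≤ n
        cG≤n = m/n*n≤m n G
        n≡ : n ≡ n % G + c * G
        n≡ = m≡m%n+[m/n]*n n G
        cG<n : c * G < n
        cG<n = subst (c * G <_) (sym n≡) (ℕ.m<n+m (c * G) (ℕ.n≢0⇒n>0 n%G≢0))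
        cg = ideal-*-closed g∈I c cG<n
        r = fzero ⊖ proj₁ cg
        r∈I : r ∈ I
        r∈I = ⊖-closed fzero (proj₁ cg) 0∈ideal (proj₁ (proj₂ cg))
        cG>0 : 0 < c * G
        cG>0 = ℕ.>-nonZero⁻¹ (c * G) {{ℕ.m*n≢0 c G {{ℕ.>-nonZero (m≥n⇒m/n>0 (ℕ.<⇒≤ (toℕ<n g)))}}}}
        r≡n%G : toℕ r ≡ n % G
        r≡n%G = begin
          toℕ r                  ≡⟨ toℕ-⊖ fzero (proj₁ cg) ⟩
          (n ∸ toℕ (proj₁ cg)) % n ≡⟨ cong (λ w → (n ∸ w) % n) (proj₂ (proj₂ cg)) ⟩
          (n ∸ c * G) % n        ≡⟨ m<n⇒m%n≡m (ℕ.∸-monoʳ-< cG>0 cG≤n) ⟩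
          n ∸ c * G              ≡⟨ cong (_∸ c * G) n≡ ⟩
          n % G + c * G ∸ c * G  ≡⟨ ℕ.m+n∸n≡m (n % G) (c * G) ⟩
          n % G                  ∎
          where open ≡-Reasoning
        r<G : toℕ r < G
        r<G = subst (_< G) (sym r≡n%G) (m%n<n n G)

  multiples : ℕ → Subset n
  multiples d = tabulate (λ x → does (d ∣? toℕ x))

  ∈multiples⇒∣ : ∀ {d x} → x ∈ multiples d → d ∣ toℕ x
  ∈multiples⇒∣ {d} {x} x∈ with d ∣? toℕ x | trans (sym (lookup∘tabulate (λ x → does (d ∣? toℕ x)) x)) ([]=⇒lookup x∈)
  ... | yes d∣x | _ = d∣x

  ∣⇒∈multiples : ∀ {d x} → d ∣ toℕ x → x ∈ multiples d
  ∣⇒∈multiples {d} {x} d∣x = lookup⇒[]= x (multiples d) (trans (lookup∘tabulate (λ x → does (d ∣? toℕ x)) x) decided)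
    where
    decided : does (d ∣? toℕ x) ≡ true
    decided with d ∣? toℕ x
    ... | yes _ = refl
    ... | no d∤x = ⊥-elim (d∤x d∣x)

  multiples-ideal : ∀ {d} → d ∣ n → IsIdeal (multiples d)
  multiples-ideal {d} d∣n = (fzero , ∣⇒∈multiples (d ∣0)) , ⊖-closed , ⊗-closed
    where
    ⊖-closed : ∀ a b → a ∈ multiples d → b ∈ multiples d → (a ⊖ b) ∈ multiples d
    ⊖-closed a b a∈ b∈ = ∣⇒∈multiples (subst (d ∣_) (sym (toℕ-⊖ a b)) (%-presˡ-∣ (∣m∣n⇒∣m+n (∈multiples⇒∣ a∈) d∣n∸b) d∣n))
      where
      d∣n∸b : d ∣ n ∸ toℕ b
      d∣n∸b = ∣m+n∣m⇒∣n (subst (d ∣_) (sym (ℕ.m+[n∸m]≡n (ℕ.<⇒≤ (toℕ<n b)))) d∣n) (∈multiples⇒∣ b∈)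
    ⊗-closed : ∀ r a → a ∈ multiples d → (r ⊗ a) ∈ multiples d
    ⊗-closed r a a∈ = ∣⇒∈multiples (subst (d ∣_) (sym (toℕ-⊗ r a)) (%-presˡ-∣ (∣n⇒∣m*n (toℕ r) (∈multiples⇒∣ a∈)) d∣n))

  ideal≡multiples : ∀ {I} → IsIdeal I → NonzeroSet I →
    ∃ λ g → g ∣ n × 0 < g × g < n × I ≡ multiples g
  ideal≡multiples {I} I-ideal I≢0 =
    toℕ g , least∣n I-ideal L , ℕ.n≢0⇒n>0 g≢0 , toℕ<n g ,
    ⊆-antisym (λ {x} x∈I → ∣⇒∈multiples (least∣member I-ideal L x x∈I)) (λ {x} x∈ → ∣least⇒member I-ideal L x (∈multiples⇒∣ x∈))
    where
    L = leastNonzero I-ideal I≢0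
    open LeastNonzero L

  ⊕-identityʳ : ∀ (x : Fin n) → x ⊕ fzero ≡ x
  ⊕-identityʳ x = toℕ-injective (trans (toℕ-⊕ x fzero) (trans (cong (_% n) (ℕ.+-identityʳ (toℕ x))) (m<n⇒m%n≡m (toℕ<n x))))

  ⊕-identityˡ : ∀ (x : Fin n) → fzero ⊕ x ≡ x
  ⊕-identityˡ x = toℕ-injective (trans (toℕ-⊕ fzero x) (m<n⇒m%n≡m (toℕ<n x)))

  ∈⇒∈sumˡ : ∀ {I K} → IsIdeal K → ∀ {x} → x ∈ I → InSum I K x
  ∈⇒∈sumˡ K-ideal {x} x∈I = x , fzero , x∈I , 0∈ideal K-ideal , sym (⊕-identityʳ x)

  ∈⇒∈sumʳ : ∀ {I K} → IsIdeal I → ∀ {x} → x ∈ K → InSum I K x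
  ∈⇒∈sumʳ I-ideal {x} x∈K = fzero , x , 0∈ideal I-ideal , x∈K , sym (⊕-identityˡ x)

  ∈⊎∈⇒∈sum : ∀ {I K} → IsIdeal I → IsIdeal K → ∀ {x} → x ∈ I ⊎ x ∈ K → InSum I K x
  ∈⊎∈⇒∈sum I-ideal K-ideal (inj₁ x∈I) = ∈⇒∈sumˡ K-ideal x∈I
  ∈⊎∈⇒∈sum I-ideal K-ideal (inj₂ x∈K) = ∈⇒∈sumʳ I-ideal x∈K

-- For n = p ^ (m + 1) * Q with p ∤ Q: the element n / p generates a minimal ideal, and it lies in
-- every ideal that has an element not divisible by p ^ (m + 1).
module Socle (k p m Q : ℕ) (n≡ : suc k ≡ p Nat.* (p ^ m Nat.* Q)) (p-prime : Prime p) (p∤Q : ¬ p ∣ Q) where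
  open import Defs
  open PrimePowers
  open import Data.Nat as ℕ using (ℕ; zero; suc; _*_; _^_; _≤_; _<_; NonZero)
  import Data.Nat.Properties as ℕ
  open import Data.Nat.Divisibility
  open import Data.Nat.Primality using (euclidsLemma; prime⇒nonZero)
  open import Data.Fin using (Fin; toℕ; fromℕ<)
  open import Data.Fin.Properties using (toℕ-fromℕ<; toℕ<n)
  open import Data.Fin.Subset using (_∈_)
  open import Data.Empty using (⊥-elim)
  open import Data.Product using (∃; _×_; _,_)
  open import Data.Sum using (_⊎_; inj₁; inj₂)
  open import Relation.Binary.PropositionalEquality
  open import Relation.Nullary using (yes; no)

  open Ideals k

  private
    instance
      p≢0 : NonZero p
      p≢0 = prime⇒nonZero p-prime
      p^m≢0 : NonZero (p ^ m)
      p^m≢0 = ℕ.m^n≢0 p m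

  cofactor : ℕ
  cofactor = p ^ m * Q

  p-part : ℕ
  p-part = p ^ suc m

  cofactor≢0 : cofactor ≢ 0
  cofactor≢0 cofactor≡0 = ℕ.0≢1+n (sym (trans n≡ (trans (cong (p *_) cofactor≡0) (ℕ.*-zeroʳ p))))

  cofactor<n : cofactor < suc k
  cofactor<n = subst (cofactor <_) (trans (ℕ.*-comm cofactor p) (sym n≡))
                     (ℕ.m<m*n cofactor p {{ℕ.≢-nonZero cofactor≢0}} (prime>1 p-prime))

  cofactorᶠ : Fin (suc k)
  cofactorᶠ = fromℕ< cofactor<n

  toℕ-cofactorᶠ : toℕ cofactorᶠ ≡ cofactor
  toℕ-cofactorᶠ = toℕ-fromℕ< cofactor<n

  cofactor∣n : cofactor ∣ suc k
  cofactor∣n = divides p n≡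

  p-part∣n : p-part ∣ suc k
  p-part∣n = divides Q (trans n≡ (trans (sym (ℕ.*-assoc p (p ^ m) Q)) (ℕ.*-comm (p * p ^ m) Q)))

  ∣n⇒p-part∤⇒∣cofactor : ∀ g → g ∣ suc k → ¬ p-part ∣ g → g ∣ cofactor
  ∣n⇒p-part∤⇒∣cofactor g (divides h n≡hg) p-part∤g with p ∣? h
  ... | no p∤h = ⊥-elim (p-part∤g (prime^∣*-cancelʳ p-prime p∤h (suc m) g
                                    (subst (p-part ∣_) (trans n≡hg (ℕ.*-comm h g)) p-part∣n)))
  ... | yes (divides h′ h≡h′p) = divides h′ (ℕ.*-cancelˡ-≡ cofactor (h′ * g) p (begin
    p * cofactor   ≡⟨ n≡ ⟨
    suc k          ≡⟨ n≡hg ⟩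
    h * g          ≡⟨ cong (_* g) (trans h≡h′p (ℕ.*-comm h′ p)) ⟩
    p * h′ * g     ≡⟨ ℕ.*-assoc p h′ g ⟩
    p * (h′ * g)   ∎))
    where open ≡-Reasoning

  cofactor∈ideal : ∀ {I} → IsIdeal I → ∀ {a} → a ∈ I → ¬ p-part ∣ toℕ a → cofactorᶠ ∈ I
  cofactor∈ideal {I} I-ideal {a} a∈I p-part∤a =
    generated (ideal≡multiples I-ideal (a , a∈I , λ a≡0 → p-part∤a (subst (p-part ∣_) (sym a≡0) (p-part ∣0))))
    where
    generated : ∃ (λ g → g ∣ suc k × 0 < g × g < suc k × I ≡ multiples g) → cofactorᶠ ∈ I
    generated (g , g∣n , _ , _ , I≡) = subst (cofactorᶠ ∈_) (sym I≡)
      (∣⇒∈multiples (subst (g ∣_) (sym toℕ-cofactorᶠ)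
        (∣n⇒p-part∤⇒∣cofactor g g∣n (λ p-part∣g → p-part∤a (∣-trans p-part∣g (∈multiples⇒∣ (subst (a ∈_) I≡ a∈I)))))))

  -- A nonzero multiple c * cofactor below n has p ∤ c, so it is not divisible by p ^ (m + 1).
  p-part∤multiple : ∀ (x : Fin (suc k)) → cofactor ∣ toℕ x → toℕ x ≢ 0 → ¬ p-part ∣ toℕ x
  p-part∤multiple x (divides c x≡c*cof) x≢0 p-part∣x = x≢0 (x≡0 (trans x≡c*cof (cong (_* cofactor) c≡c′p)))
    where
    p^m*p∣ : p ^ m * p ∣ p ^ m * (c * Q)
    p^m*p∣ = subst₂ _∣_ (ℕ.*-comm p (p ^ m)) (trans x≡c*cof regroup) p-part∣x
      where
      regroup : c * (p ^ m * Q) ≡ p ^ m * (c * Q)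
      regroup = trans (sym (ℕ.*-assoc c (p ^ m) Q)) (trans (cong (_* Q) (ℕ.*-comm c (p ^ m))) (ℕ.*-assoc (p ^ m) c Q))
    p∣c : p ∣ c
    p∣c with euclidsLemma c Q p-prime (*-cancelˡ-∣ (p ^ m) p^m*p∣)
    ... | inj₁ p∣c = p∣c
    ... | inj₂ p∣Q = ⊥-elim (p∤Q p∣Q)
    c≡c′p : c ≡ quotient p∣c * p
    c≡c′p = _∣_.equality p∣c
    x≡0 : toℕ x ≡ quotient p∣c * p * cofactor → toℕ x ≡ 0
    x≡0 x≡ with quotient p∣c
    ... | zero = x≡
    ... | suc c″ = ⊥-elim (ℕ.<-irrefl refl (ℕ.<-≤-trans (toℕ<n x) (subst (suc k ≤_) (sym x≡) n≤)))
      where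
      n≤ : suc k ≤ suc c″ * p * cofactor
      n≤ = subst (_≤ suc c″ * p * cofactor) (sym n≡) (ℕ.*-monoˡ-≤ cofactor (ℕ.m≤m+n p (c″ * p)))

  p-part∣⊕ : ∀ (a b : Fin (suc k)) → p-part ∣ toℕ a → p-part ∣ toℕ b → p-part ∣ toℕ (a ⊕ b)
  p-part∣⊕ a b p-part∣a p-part∣b = subst (p-part ∣_) (sym (toℕ-⊕ a b)) (%-presˡ-∣ (∣m∣n⇒∣m+n p-part∣a p-part∣b) p-part∣n)

  cofactor-nonzero : NonzeroSet (multiples cofactor)
  cofactor-nonzero = cofactorᶠ , ∣⇒∈multiples (subst (cofactor ∣_) (sym toℕ-cofactorᶠ) ∣-refl) ,
                     λ e → cofactor≢0 (trans (sym toℕ-cofactorᶠ) e)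

  -- The ideal generated by n / p is nonzero, so I + K meets it in some nonzero a + b; not both
  -- of a and b can be divisible by p ^ (m + 1).
  essential⇒cofactor∈ : ∀ {I K} → IsIdeal I → IsIdeal K → IsEssential (InSum I K) → cofactorᶠ ∈ I ⊎ cofactorᶠ ∈ K
  essential⇒cofactor∈ {I} {K} I-ideal K-ideal essential =
    split (essential (multiples cofactor) (multiples-ideal cofactor∣n) cofactor-nonzero)
    where
    split : (∃ λ x → InSum I K x × x ∈ multiples cofactor × toℕ x ≢ 0) → cofactorᶠ ∈ I ⊎ cofactorᶠ ∈ K
    split (x , (a , b , a∈I , b∈K , x≡a⊕b) , x∈ , x≢0) with p-part ∣? toℕ a | p-part ∣? toℕ b
    ... | no p-part∤a | _ = inj₁ (cofactor∈ideal I-ideal a∈I p-part∤a)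
    ... | yes _ | no p-part∤b = inj₂ (cofactor∈ideal K-ideal b∈K p-part∤b)
    ... | yes p-part∣a | yes p-part∣b =
      ⊥-elim (p-part∤multiple x (∈multiples⇒∣ x∈) x≢0 (subst (λ z → p-part ∣ toℕ z) (sym x≡a⊕b) (p-part∣⊕ a b p-part∣a p-part∣b)))

module Graph (k p q m₁′ m₂′ : ℕ) (n≡ : suc k ≡ p ^ suc m₁′ Nat.* q ^ suc m₂′)
             (p-prime : Prime p) (q-prime : Prime q) (p≢q : p ≢ q) where
  open import Defs
  open PrimePowers
  open TypeMatrix using (Type; X; Y; Z; weight)
  open import Data.Nat as ℕ using (ℕ; zero; suc; _*_; _^_; _≤_; _<_; NonZero; z≤n; s≤s)
  import Data.Nat.Properties as ℕ
  open import Data.Nat.Divisibility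
  open import Data.Nat.Primality using (prime⇒nonZero)
  open import Data.Fin using (Fin; toℕ; fromℕ<)
  open import Data.Fin.Properties using (toℕ-fromℕ<; toℕ<n)
  open import Data.Fin.Subset using (Subset; _∈_; _∉_)
  open import Data.Fin.Subset.Properties using (_∈?_)
  open import Data.Empty using (⊥-elim)
  open import Data.Product using (∃; ∃₂; _×_; _,_; proj₁)
  open import Data.Sum using (_⊎_; inj₁; inj₂)
  open import Relation.Binary.PropositionalEquality
  open import Data.Integer using (+_)
  open import Relation.Nullary using (yes; no; Dec; ¬_)

  open Ideals k

  private
    instance
      p≢0 : NonZero p
      p≢0 = prime⇒nonZero p-prime
      q≢0 : NonZero q
      q≢0 = prime⇒nonZero q-prime
    q≢p : q ≢ p
    q≢p q≡p = p≢q (sym q≡p)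

  pᵃ qᵇ : ℕ
  pᵃ = p ^ suc m₁′
  qᵇ = q ^ suc m₂′

  module P = Socle k p m₁′ qᵇ (trans n≡ (ℕ.*-assoc p (p ^ m₁′) qᵇ)) p-prime (prime∤prime^ p-prime q-prime p≢q (suc m₂′))
  module Q = Socle k q m₂′ pᵃ (trans n≡ (trans (ℕ.*-comm pᵃ qᵇ) (ℕ.*-assoc q (q ^ m₂′) pᵃ))) q-prime
                               (prime∤prime^ q-prime p-prime q≢p (suc m₁′))

  n/p n/q : Fin (suc k)
  n/p = P.cofactorᶠ
  n/q = Q.cofactorᶠ

  -- A nonzero element divisible by both p ^ a and q ^ b would be a positive multiple of n.
  nonzero-ideal-meets-socle : ∀ {J} → IsIdeal J → NonzeroSet J → n/p ∈ J ⊎ n/q ∈ J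
  nonzero-ideal-meets-socle {J} J-ideal (x , x∈J , x≢0) with P.p-part ∣? toℕ x | Q.p-part ∣? toℕ x
  ... | no pᵃ∤x | _ = inj₁ (P.cofactor∈ideal J-ideal x∈J pᵃ∤x)
  ... | yes _ | no qᵇ∤x = inj₂ (Q.cofactor∈ideal J-ideal x∈J qᵇ∤x)
  ... | yes pᵃ∣x | yes qᵇ∣x = ⊥-elim (x≢0 (both (toℕ x) pᵃ∣x qᵇ∣x (toℕ<n x)))
    where
    both : ∀ y → pᵃ ∣ y → qᵇ ∣ y → y < suc k → y ≡ 0
    both y (divides c refl) qᵇ∣cpᵃ y<n
      with divides c′ refl ← prime^∣*-cancelʳ q-prime (prime∤prime^ q-prime p-prime q≢p (suc m₁′)) (suc m₂′) c qᵇ∣cpᵃ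
      with c′
    ... | zero = refl
    ... | suc c″ = ⊥-elim (ℕ.<-irrefl refl (ℕ.<-≤-trans y<n (subst (_≤ suc c″ * qᵇ * pᵃ) (sym (trans n≡ (ℕ.*-comm pᵃ qᵇ)))
                                                              (ℕ.*-monoˡ-≤ pᵃ (ℕ.m≤m+n qᵇ (c″ * qᵇ))))))

  essAdj⇒ : ∀ {I K} → IsIdeal I → IsIdeal K → EssAdj I K → (n/p ∈ I ⊎ n/p ∈ K) × (n/q ∈ I ⊎ n/q ∈ K)
  essAdj⇒ I-ideal K-ideal essential =
    P.essential⇒cofactor∈ I-ideal K-ideal essential , Q.essential⇒cofactor∈ I-ideal K-ideal essential

  essAdj⇐ : ∀ {I K} → IsIdeal I → IsIdeal K → (n/p ∈ I ⊎ n/p ∈ K) × (n/q ∈ I ⊎ n/q ∈ K) → EssAdj I K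
  essAdj⇐ {I} {K} I-ideal K-ideal (n/p∈ , n/q∈) J J-ideal J≢0 with nonzero-ideal-meets-socle J-ideal J≢0
  ... | inj₁ n/p∈J = n/p , ∈⊎∈⇒∈sum I-ideal K-ideal n/p∈ , n/p∈J , λ e → P.cofactor≢0 (trans (sym P.toℕ-cofactorᶠ) e)
  ... | inj₂ n/q∈J = n/q , ∈⊎∈⇒∈sum I-ideal K-ideal n/q∈ , n/q∈J , λ e → Q.cofactor≢0 (trans (sym Q.toℕ-cofactorᶠ) e)

  -- X: both generators, Y: only n / q, Z: only n / p (no vertex contains neither).
  typeFrom : ∀ {A B : Set} → Dec A → Dec B → Type
  typeFrom (yes _) (yes _) = X
  typeFrom (no _)  (yes _) = Y
  typeFrom (yes _) (no _)  = Z
  typeFrom (no _)  (no _)  = X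

  typeOf : Subset (suc k) → Type
  typeOf I = typeFrom (n/p ∈? I) (n/q ∈? I)

  weight-typeFrom : ∀ {A₁ B₁ A₂ B₂ : Set} (a₁ : Dec A₁) (b₁ : Dec B₁) (a₂ : Dec A₂) (b₂ : Dec B₂) → A₁ ⊎ B₁ → A₂ ⊎ B₂ →
    let Covered = (A₁ ⊎ A₂) × (B₁ ⊎ B₂) in
    (weight (typeFrom a₁ b₁) (typeFrom a₂ b₂) ≡ + 1 × Covered) ⊎ (weight (typeFrom a₁ b₁) (typeFrom a₂ b₂) ≡ + 0 × ¬ Covered)
  weight-typeFrom (yes a₁) (yes b₁) (yes _) (yes _) _ _ = inj₁ (refl , inj₁ a₁ , inj₁ b₁)
  weight-typeFrom (yes a₁) (yes b₁) (no _)  (yes _) _ _ = inj₁ (refl , inj₁ a₁ , inj₁ b₁)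
  weight-typeFrom (yes a₁) (yes b₁) (yes _) (no _)  _ _ = inj₁ (refl , inj₁ a₁ , inj₁ b₁)
  weight-typeFrom (yes a₁) (yes b₁) (no _)  (no _)  _ _ = inj₁ (refl , inj₁ a₁ , inj₁ b₁)
  weight-typeFrom (no ¬a₁) (no ¬b₁) _ _ (inj₁ a₁) _ = ⊥-elim (¬a₁ a₁)
  weight-typeFrom (no ¬a₁) (no ¬b₁) _ _ (inj₂ b₁) _ = ⊥-elim (¬b₁ b₁)
  weight-typeFrom _ _ (no ¬a₂) (no ¬b₂) _ (inj₁ a₂) = ⊥-elim (¬a₂ a₂)
  weight-typeFrom _ _ (no ¬a₂) (no ¬b₂) _ (inj₂ b₂) = ⊥-elim (¬b₂ b₂)
  weight-typeFrom (no _)   (yes b₁) (yes a₂) (yes _)  _ _ = inj₁ (refl , inj₂ a₂ , inj₁ b₁)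
  weight-typeFrom (yes a₁) (no _)   (yes _)  (yes b₂) _ _ = inj₁ (refl , inj₁ a₁ , inj₂ b₂)
  weight-typeFrom (no ¬a₁) (yes _)  (no ¬a₂) (yes _)  _ _ = inj₂ (refl , λ { (inj₁ a₁ , _) → ¬a₁ a₁ ; (inj₂ a₂ , _) → ¬a₂ a₂ })
  weight-typeFrom (no _)   (yes b₁) (yes a₂) (no _)   _ _ = inj₁ (refl , inj₂ a₂ , inj₁ b₁)
  weight-typeFrom (yes a₁) (no _)   (no _)   (yes b₂) _ _ = inj₁ (refl , inj₁ a₁ , inj₂ b₂)
  weight-typeFrom (yes _)  (no ¬b₁) (yes _)  (no ¬b₂) _ _ = inj₂ (refl , λ { (_ , inj₁ b₁) → ¬b₁ b₁ ; (_ , inj₂ b₂) → ¬b₂ b₂ })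

  vertex-meets-socle : ∀ {I} → IsVertex I → n/p ∈ I ⊎ n/q ∈ I
  vertex-meets-socle (I-ideal , I≢0 , _) = nonzero-ideal-meets-socle I-ideal I≢0

  weight-typeOf : ∀ {I K} → IsVertex I → IsVertex K →
    (weight (typeOf I) (typeOf K) ≡ + 1 × EssAdj I K) ⊎ (weight (typeOf I) (typeOf K) ≡ + 0 × ¬ EssAdj I K)
  weight-typeOf {I} {K} I-vertex K-vertex
    with weight-typeFrom (n/p ∈? I) (n/q ∈? I) (n/p ∈? K) (n/q ∈? K) (vertex-meets-socle I-vertex) (vertex-meets-socle K-vertex)
  ... | inj₁ (w≡1 , covered) = inj₁ (w≡1 , essAdj⇐ (proj₁ I-vertex) (proj₁ K-vertex) covered)
  ... | inj₂ (w≡0 , ¬covered) = inj₂ (w≡0 , λ essential → ¬covered (essAdj⇒ (proj₁ I-vertex) (proj₁ K-vertex) essential))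

  divisor : ℕ → ℕ → ℕ
  divisor α β = p ^ α * q ^ β

  private
    p^≢0 : ∀ α → NonZero (p ^ α)
    p^≢0 α = ℕ.m^n≢0 p α
    q^≢0 : ∀ β → NonZero (q ^ β)
    q^≢0 β = ℕ.m^n≢0 q β

  divisor∣n : ∀ α β → α ≤ suc m₁′ → β ≤ suc m₂′ → divisor α β ∣ suc k
  divisor∣n α β α≤ β≤ = subst (divisor α β ∣_) (sym n≡) (*-pres-∣ (^-monoʳ-∣ p α≤) (^-monoʳ-∣ q β≤))

  divisor<n : ∀ α β → α ≤ suc m₁′ → β ≤ suc m₂′ → α < suc m₁′ ⊎ β < suc m₂′ → divisor α β < suc k
  divisor<n α β α≤ β≤ (inj₁ α<) = subst (divisor α β <_) (sym n≡)
    (ℕ.≤-<-trans (ℕ.*-monoʳ-≤ (p ^ α) (ℕ.^-monoʳ-≤ q β≤)) (ℕ.*-monoˡ-< qᵇ {{q^≢0 (suc m₂′)}} (ℕ.^-monoʳ-< p (prime>1 p-prime) α<)))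
  divisor<n α β α≤ β≤ (inj₂ β<) = subst (divisor α β <_) (sym n≡)
    (ℕ.≤-<-trans (ℕ.*-monoˡ-≤ (q ^ β) (ℕ.^-monoʳ-≤ p α≤)) (ℕ.*-monoʳ-< pᵃ {{p^≢0 (suc m₁′)}} (ℕ.^-monoʳ-< q (prime>1 q-prime) β<)))

  1<divisor : ∀ α β → 0 < α ⊎ 0 < β → 1 < divisor α β
  1<divisor α β (inj₁ 0<α) = ℕ.<-≤-trans (ℕ.^-monoʳ-< p (prime>1 p-prime) 0<α) (ℕ.m≤m*n (p ^ α) (q ^ β) {{q^≢0 β}})
  1<divisor α β (inj₂ 0<β) = ℕ.<-≤-trans (ℕ.^-monoʳ-< q (prime>1 q-prime) 0<β) (ℕ.m≤n*m (q ^ β) (p ^ α) {{p^≢0 α}})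

  divisor-injective : ∀ α β α′ β′ → divisor α β ≡ divisor α′ β′ → α ≡ α′ × β ≡ β′
  divisor-injective α β α′ β′ eq =
    ℕ.≤-antisym (prime^*prime^-∣⇒≤ p-prime q-prime p≢q α β α′ β′ (∣-reflexive eq))
                (prime^*prime^-∣⇒≤ p-prime q-prime p≢q α′ β′ α β (∣-reflexive (sym eq))) ,
    ℕ.≤-antisym (prime^*prime^-∣⇒≤ q-prime p-prime q≢p β α β′ α′ (∣-reflexive (commute α β α′ β′ eq)))
                (prime^*prime^-∣⇒≤ q-prime p-prime q≢p β′ α′ β α (∣-reflexive (commute α′ β′ α β (sym eq))))
    where
    commute : ∀ a b a′ b′ → p ^ a * q ^ b ≡ p ^ a′ * q ^ b′ → q ^ b * p ^ a ≡ q ^ b′ * p ^ a′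
    commute a b a′ b′ e = trans (ℕ.*-comm (q ^ b) (p ^ a)) (trans e (ℕ.*-comm (p ^ a′) (q ^ b′)))

  multiples-vertex : ∀ {d} → d ∣ suc k → 1 < d → d < suc k → IsVertex (multiples d)
  multiples-vertex {d} d∣n 1<d d<n =
    multiples-ideal d∣n ,
    (fromℕ< d<n , ∣⇒∈multiples (subst (d ∣_) (sym (toℕ-fromℕ< d<n)) ∣-refl) ,
     λ d≡0 → ℕ.<-irrefl (sym (trans (sym (toℕ-fromℕ< d<n)) d≡0)) (ℕ.<-trans (s≤s z≤n) 1<d)) ,
    (fromℕ< 1<n , λ 1∈ → ℕ.<-irrefl (sym (∣1⇒≡1 (subst (d ∣_) (toℕ-fromℕ< 1<n) (∈multiples⇒∣ 1∈)))) 1<d)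
    where
    1<n : 1 < suc k
    1<n = ℕ.<-trans 1<d d<n

  multiples-injective : ∀ {d d′} → d < suc k → d′ < suc k → multiples d ≡ multiples d′ → d ≡ d′
  multiples-injective {d} {d′} d<n d′<n eq = ∣-antisym (in-other d′<n (sym eq)) (in-other d<n eq)
    where
    in-other : ∀ {a b} (a<n : a < suc k) → multiples a ≡ multiples b → b ∣ a
    in-other {a} {b} a<n eq = subst (b ∣_) (toℕ-fromℕ< a<n)
      (∈multiples⇒∣ (subst (fromℕ< a<n ∈_) eq (∣⇒∈multiples (subst (a ∣_) (sym (toℕ-fromℕ< a<n)) ∣-refl))))

  record DivisorForm (I : Subset (suc k)) : Set where
    field
      α β : ℕ
      α≤ : α ≤ suc m₁′
      β≤ : β ≤ suc m₂′
      ≢1 : ¬ (α ≡ 0 × β ≡ 0)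
      I≡ : I ≡ multiples (divisor α β)

  vertex⇒divisorForm : ∀ {I} → IsVertex I → DivisorForm I
  vertex⇒divisorForm {I} (I-ideal , I≢0 , (a , a∉I)) = from-generator (ideal≡multiples I-ideal I≢0)
    where
    from-generator : ∃ (λ g → g ∣ suc k × 0 < g × g < suc k × I ≡ multiples g) → DivisorForm I
    from-generator (g , g∣n , _ , _ , I≡g) = from-exponents (divisor-of-prime^*prime^ p-prime q-prime (suc m₁′) (suc m₂′) g (subst (g ∣_) n≡ g∣n))
      where
      from-exponents : (∃₂ λ α β → α ≤ suc m₁′ × β ≤ suc m₂′ × g ≡ divisor α β) → DivisorForm I
      from-exponents (α , β , α≤ , β≤ , g≡) = record { α = α ; β = β ; α≤ = α≤ ; β≤ = β≤ ; ≢1 = ≢1 ; I≡ = trans I≡g (cong multiples g≡) }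
        where
        ≢1 : ¬ (α ≡ 0 × β ≡ 0)
        ≢1 (refl , refl) = a∉I (subst (a ∈_) (sym I≡g) (∣⇒∈multiples (subst (_∣ toℕ a) (sym g≡) (1∣ toℕ a))))

  n/p∈multiples : ∀ α β → α ≤ m₁′ → β ≤ suc m₂′ → n/p ∈ multiples (divisor α β)
  n/p∈multiples α β α≤ β≤ = ∣⇒∈multiples (subst (divisor α β ∣_) (sym P.toℕ-cofactorᶠ) (*-pres-∣ (^-monoʳ-∣ p α≤) (^-monoʳ-∣ q β≤)))

  n/p∈multiples⇒ : ∀ α β → n/p ∈ multiples (divisor α β) → α ≤ m₁′
  n/p∈multiples⇒ α β n/p∈ = prime^*prime^-∣⇒≤ p-prime q-prime p≢q α β m₁′ (suc m₂′) (subst (divisor α β ∣_) P.toℕ-cofactorᶠ (∈multiples⇒∣ n/p∈))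

  n/q∈multiples : ∀ α β → α ≤ suc m₁′ → β ≤ m₂′ → n/q ∈ multiples (divisor α β)
  n/q∈multiples α β α≤ β≤ = ∣⇒∈multiples (subst (divisor α β ∣_) (sym Q.toℕ-cofactorᶠ)
    (subst (_∣ q ^ m₂′ * pᵃ) (ℕ.*-comm (q ^ β) (p ^ α)) (*-pres-∣ (^-monoʳ-∣ q β≤) (^-monoʳ-∣ p α≤))))

  n/q∈multiples⇒ : ∀ α β → n/q ∈ multiples (divisor α β) → β ≤ m₂′
  n/q∈multiples⇒ α β n/q∈ = prime^*prime^-∣⇒≤ q-prime p-prime q≢p β α m₂′ (suc m₁′)
    (subst (_∣ q ^ m₂′ * pᵃ) (ℕ.*-comm (p ^ α) (q ^ β)) (subst (divisor α β ∣_) Q.toℕ-cofactorᶠ (∈multiples⇒∣ n/q∈)))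

  typeOf-multiples-X : ∀ α β → α ≤ m₁′ → β ≤ m₂′ → typeOf (multiples (divisor α β)) ≡ X
  typeOf-multiples-X α β α≤ β≤ with n/p ∈? multiples (divisor α β) | n/q ∈? multiples (divisor α β)
  ... | yes _ | yes _ = refl
  ... | no n/p∉ | _ = ⊥-elim (n/p∉ (n/p∈multiples α β α≤ (ℕ.m≤n⇒m≤1+n β≤)))
  ... | yes _ | no n/q∉ = ⊥-elim (n/q∉ (n/q∈multiples α β (ℕ.m≤n⇒m≤1+n α≤) β≤))

  typeOf-multiples-Y : ∀ β → β ≤ m₂′ → typeOf (multiples (divisor (suc m₁′) β)) ≡ Y
  typeOf-multiples-Y β β≤ with n/p ∈? multiples (divisor (suc m₁′) β) | n/q ∈? multiples (divisor (suc m₁′) β)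
  ... | no _ | yes _ = refl
  ... | yes n/p∈ | _ = ⊥-elim (ℕ.<-irrefl refl (n/p∈multiples⇒ (suc m₁′) β n/p∈))
  ... | no _ | no n/q∉ = ⊥-elim (n/q∉ (n/q∈multiples (suc m₁′) β ℕ.≤-refl β≤))

  typeOf-multiples-Z : ∀ α → α ≤ m₁′ → typeOf (multiples (divisor α (suc m₂′))) ≡ Z
  typeOf-multiples-Z α α≤ with n/p ∈? multiples (divisor α (suc m₂′)) | n/q ∈? multiples (divisor α (suc m₂′))
  ... | yes _ | no _ = refl
  ... | _ | yes n/q∈ = ⊥-elim (ℕ.<-irrefl refl (n/q∈multiples⇒ α (suc m₂′) n/q∈))
  ... | no n/p∉ | no _ = ⊥-elim (n/p∉ (n/p∈multiples α (suc m₂′) α≤ ℕ.≤-refl))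

  typeOf≡X⇒ : ∀ {I} → IsVertex I → typeOf I ≡ X → n/p ∈ I × n/q ∈ I
  typeOf≡X⇒ {I} I-vertex tI≡X with n/p ∈? I | n/q ∈? I | vertex-meets-socle I-vertex
  typeOf≡X⇒ I-vertex tI≡X | yes n/p∈ | yes n/q∈ | _ = n/p∈ , n/q∈
  typeOf≡X⇒ I-vertex ()   | no _     | yes _    | _
  typeOf≡X⇒ I-vertex ()   | yes _    | no _     | _
  typeOf≡X⇒ I-vertex tI≡X | no n/p∉  | no _     | inj₁ n/p∈ = ⊥-elim (n/p∉ n/p∈)
  typeOf≡X⇒ I-vertex tI≡X | no _     | no n/q∉  | inj₂ n/q∈ = ⊥-elim (n/q∉ n/q∈)

  typeOf≡Y⇒ : ∀ {I} → typeOf I ≡ Y → n/p ∉ I × n/q ∈ I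
  typeOf≡Y⇒ {I} tI≡Y with n/p ∈? I | n/q ∈? I
  typeOf≡Y⇒ ()   | yes _   | yes _
  typeOf≡Y⇒ tI≡Y | no n/p∉ | yes n/q∈ = n/p∉ , n/q∈
  typeOf≡Y⇒ ()   | yes _   | no _
  typeOf≡Y⇒ ()   | no _    | no _

  typeOf≡Z⇒ : ∀ {I} → typeOf I ≡ Z → n/p ∈ I × n/q ∉ I
  typeOf≡Z⇒ {I} tI≡Z with n/p ∈? I | n/q ∈? I
  typeOf≡Z⇒ ()   | yes _    | yes _
  typeOf≡Z⇒ ()   | no _     | yes _
  typeOf≡Z⇒ tI≡Z | yes n/p∈ | no n/q∉ = n/p∈ , n/q∉
  typeOf≡Z⇒ ()   | no _     | no _

module VertexCount (k p q m₁′ m₂′ : ℕ) (n≡ : suc k ≡ p ^ suc m₁′ Nat.* q ^ suc m₂′)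
                   (p-prime : Prime p) (q-prime : Prime q) (p≢q : p ≢ q)
                   (N : ℕ) (v : Fin N → Subset (suc k)) (v-injective : Injective _≡_ _≡_ v)
                   (v-vertex : ∀ i → IsVertex (v i)) (v-onto : ∀ I → IsVertex I → ∃ λ i → v i ≡ I) where
  open import Defs
  open TypeMatrix using (Type; X; Y; Z; count)
  open import Data.Nat as ℕ using (ℕ; zero; suc; _*_; _^_; _≤_; _<_; z≤n; s≤s)
  import Data.Nat.Properties as ℕ
  open import Data.Nat.Divisibility using (_∣_; 1∣_)
  open import Data.Fin using (Fin; toℕ; fromℕ<; combine; remQuot) renaming (zero to fzero; suc to fsuc)
  open import Data.Fin.Properties using (toℕ-injective; toℕ-fromℕ<; toℕ<n; toℕ≤pred[n]; remQuot-combine; combine-remQuot)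
  open import Data.Fin.Subset using (Subset; _∈_)
  open import Data.Empty using (⊥-elim)
  open import Data.Product using (∃; _×_; _,_; proj₁; proj₂)
  open import Data.Sum using (_⊎_; inj₁; inj₂)
  open import Function.Definitions using (Injective)
  open import Relation.Binary.PropositionalEquality
  open import Relation.Nullary using (yes; no)
  open Counting using (count-enumeration)


  open Ideals k
  open Graph k p q m₁′ m₂′ n≡ p-prime q-prime p≢q

  -- d lists the generators of the ideals of type U among w, each exactly once.
  count-multiples : ∀ {M} (w : Fin M → Subset (suc k)) → Injective _≡_ _≡_ w → ∀ U {m} (d : Fin m → ℕ) →
    Injective _≡_ _≡_ d → (∀ b → d b < suc k) → (∀ b → ∃ λ i → w i ≡ multiples (d b)) →
    (∀ b → typeOf (multiples (d b)) ≡ U) → (∀ i → typeOf (w i) ≡ U → ∃ λ b → w i ≡ multiples (d b)) →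
    count (λ i → typeOf (w i)) U ≡ m
  count-multiples w w-inj U d d-inj d<n d-listed d-typed d-onto =
    count-enumeration (λ i → typeOf (w i)) U index index-inj index-typed index-onto
    where
    index : _ → _
    index b = proj₁ (d-listed b)
    index-inj : Injective _≡_ _≡_ index
    index-inj {a} {b} eq = d-inj (multiples-injective (d<n a) (d<n b)
      (trans (sym (proj₂ (d-listed a))) (trans (cong w eq) (proj₂ (d-listed b)))))
    index-typed : ∀ b → typeOf (w (index b)) ≡ U
    index-typed b = trans (cong typeOf (proj₂ (d-listed b))) (d-typed b)
    index-onto : ∀ i → typeOf (w i) ≡ U → ∃ λ b → index b ≡ i
    index-onto i wᵢ-typed with b , wᵢ≡ ← d-onto i wᵢ-typed = b , w-inj (trans (proj₂ (d-listed b)) (sym wᵢ≡))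

  vertex-listed : ∀ {d} → d ∣ suc k → 1 < d → d < suc k → ∃ λ i → v i ≡ multiples d
  vertex-listed d∣n 1<d d<n = v-onto _ (multiples-vertex d∣n 1<d d<n)

  count-Y : count (λ i → typeOf (v i)) Y ≡ suc m₂′
  count-Y = count-multiples v v-injective Y d d-inj d<n d-listed d-typed d-onto
    where
    d : Fin (suc m₂′) → ℕ
    d b = divisor (suc m₁′) (toℕ b)
    d<n : ∀ b → d b < suc k
    d<n b = divisor<n (suc m₁′) (toℕ b) ℕ.≤-refl (ℕ.<⇒≤ (toℕ<n b)) (inj₂ (toℕ<n b))
    d-inj : Injective _≡_ _≡_ d
    d-inj {a} {b} eq = toℕ-injective (proj₂ (divisor-injective (suc m₁′) (toℕ a) (suc m₁′) (toℕ b) eq))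
    d-listed : ∀ b → ∃ λ i → v i ≡ multiples (d b)
    d-listed b = vertex-listed (divisor∣n (suc m₁′) (toℕ b) ℕ.≤-refl (ℕ.<⇒≤ (toℕ<n b))) (1<divisor (suc m₁′) (toℕ b) (inj₁ (s≤s z≤n))) (d<n b)
    d-typed : ∀ b → typeOf (multiples (d b)) ≡ Y
    d-typed b = typeOf-multiples-Y (toℕ b) (toℕ≤pred[n] b)
    d-onto : ∀ i → typeOf (v i) ≡ Y → ∃ λ b → v i ≡ multiples (d b)
    d-onto i vᵢ-typed with n/p∉ , n/q∈ ← typeOf≡Y⇒ vᵢ-typed =
      fromℕ< (s≤s β≤m₂′) , trans I≡ (cong₂ (λ a b → multiples (divisor a b)) α≡m₁ (sym (toℕ-fromℕ< (s≤s β≤m₂′))))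
      where
      open DivisorForm (vertex⇒divisorForm (v-vertex i))
      β≤m₂′ : β ≤ m₂′
      β≤m₂′ = n/q∈multiples⇒ α β (subst (n/q ∈_) I≡ n/q∈)
      α≡m₁ : α ≡ suc m₁′
      α≡m₁ = ℕ.≤-antisym α≤ (ℕ.≰⇒> λ α≤m₁′ → n/p∉ (subst (n/p ∈_) (sym I≡) (n/p∈multiples α β α≤m₁′ β≤)))

  count-Z : count (λ i → typeOf (v i)) Z ≡ suc m₁′
  count-Z = count-multiples v v-injective Z d d-inj d<n d-listed d-typed d-onto
    where
    d : Fin (suc m₁′) → ℕ
    d a = divisor (toℕ a) (suc m₂′)
    d<n : ∀ a → d a < suc k
    d<n a = divisor<n (toℕ a) (suc m₂′) (ℕ.<⇒≤ (toℕ<n a)) ℕ.≤-refl (inj₁ (toℕ<n a))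
    d-inj : Injective _≡_ _≡_ d
    d-inj {a} {b} eq = toℕ-injective (proj₁ (divisor-injective (toℕ a) (suc m₂′) (toℕ b) (suc m₂′) eq))
    d-listed : ∀ a → ∃ λ i → v i ≡ multiples (d a)
    d-listed a = vertex-listed (divisor∣n (toℕ a) (suc m₂′) (ℕ.<⇒≤ (toℕ<n a)) ℕ.≤-refl) (1<divisor (toℕ a) (suc m₂′) (inj₂ (s≤s z≤n))) (d<n a)
    d-typed : ∀ a → typeOf (multiples (d a)) ≡ Z
    d-typed a = typeOf-multiples-Z (toℕ a) (toℕ≤pred[n] a)
    d-onto : ∀ i → typeOf (v i) ≡ Z → ∃ λ a → v i ≡ multiples (d a)
    d-onto i vᵢ-typed with n/p∈ , n/q∉ ← typeOf≡Z⇒ vᵢ-typed =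
      fromℕ< (s≤s α≤m₁′) , trans I≡ (cong₂ (λ a b → multiples (divisor a b)) (sym (toℕ-fromℕ< (s≤s α≤m₁′))) β≡m₂)
      where
      open DivisorForm (vertex⇒divisorForm (v-vertex i))
      α≤m₁′ : α ≤ m₁′
      α≤m₁′ = n/p∈multiples⇒ α β (subst (n/p ∈_) I≡ n/p∈)
      β≡m₂ : β ≡ suc m₂′
      β≡m₂ = ℕ.≤-antisym β≤ (ℕ.≰⇒> λ β≤m₂′ → n/q∉ (subst (n/q ∈_) (sym I≡) (n/q∈multiples α β α≤ β≤m₂′)))

  -- Prepending the non-vertex ideal ℤ_n = multiples 1 completes the X-type ideals to a grid.
  count-X : suc (count (λ i → typeOf (v i)) X) ≡ suc m₁′ * suc m₂′
  count-X = trans (cong (λ T → TypeMatrix.indicator T X ℕ.+ count (λ i → typeOf (v i)) X) (sym whole-typed))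
                  (count-multiples w w-inj X d d-inj d<n d-listed d-typed d-onto)
    where
    whole : Subset (suc k)
    whole = multiples (divisor 0 0)
    whole-typed : typeOf whole ≡ X
    whole-typed = typeOf-multiples-X 0 0 z≤n z≤n
    w : Fin (suc N) → Subset (suc k)
    w fzero    = whole
    w (fsuc i) = v i
    whole≢vertex : ∀ i → whole ≢ v i
    whole≢vertex i whole≡vᵢ with a , a∉vᵢ ← proj₂ (proj₂ (v-vertex i)) = a∉vᵢ (subst (a ∈_) whole≡vᵢ (∣⇒∈multiples (1∣ toℕ a)))
    w-inj : Injective _≡_ _≡_ w
    w-inj {fzero}  {fzero}  _   = refl
    w-inj {fzero}  {fsuc j} eq  = ⊥-elim (whole≢vertex j eq)
    w-inj {fsuc i} {fzero}  eq  = ⊥-elim (whole≢vertex i (sym eq))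
    w-inj {fsuc i} {fsuc j} eq  = cong fsuc (v-injective eq)
    exponents : Fin (suc m₁′ * suc m₂′) → Fin (suc m₁′) × Fin (suc m₂′)
    exponents = remQuot (suc m₂′)
    α⟨_⟩ β⟨_⟩ : Fin (suc m₁′ * suc m₂′) → ℕ
    α⟨ c ⟩ = toℕ (proj₁ (exponents c))
    β⟨ c ⟩ = toℕ (proj₂ (exponents c))
    d : Fin (suc m₁′ * suc m₂′) → ℕ
    d c = divisor α⟨ c ⟩ β⟨ c ⟩
    d-combine : ∀ a b → d (combine a b) ≡ divisor (toℕ a) (toℕ b)
    d-combine a b = cong (λ ab → divisor (toℕ (proj₁ ab)) (toℕ (proj₂ ab))) (remQuot-combine a b)
    α⟨⟩≤ : ∀ c → α⟨ c ⟩ ≤ suc m₁′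
    α⟨⟩≤ c = ℕ.<⇒≤ (toℕ<n (proj₁ (exponents c)))
    β⟨⟩≤ : ∀ c → β⟨ c ⟩ ≤ suc m₂′
    β⟨⟩≤ c = ℕ.<⇒≤ (toℕ<n (proj₂ (exponents c)))
    d<n : ∀ c → d c < suc k
    d<n c = divisor<n α⟨ c ⟩ β⟨ c ⟩ (α⟨⟩≤ c) (β⟨⟩≤ c) (inj₁ (toℕ<n (proj₁ (exponents c))))
    d-inj : Injective _≡_ _≡_ d
    d-inj {c} {c′} eq with α≡ , β≡ ← divisor-injective α⟨ c ⟩ β⟨ c ⟩ α⟨ c′ ⟩ β⟨ c′ ⟩ eq =
      trans (sym (combine-remQuot {suc m₁′} (suc m₂′) c))
            (trans (cong₂ combine (toℕ-injective α≡) (toℕ-injective β≡)) (combine-remQuot {suc m₁′} (suc m₂′) c′))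
    as-vertex : ∀ c → 0 < α⟨ c ⟩ ⊎ 0 < β⟨ c ⟩ → ∃ λ i → w i ≡ multiples (d c)
    as-vertex c 0<e with i , vᵢ≡ ← vertex-listed (divisor∣n α⟨ c ⟩ β⟨ c ⟩ (α⟨⟩≤ c) (β⟨⟩≤ c)) (1<divisor α⟨ c ⟩ β⟨ c ⟩ 0<e) (d<n c) =
      fsuc i , vᵢ≡
    d-listed : ∀ c → ∃ λ i → w i ≡ multiples (d c)
    d-listed c with α⟨ c ⟩ ℕ.≟ 0 | β⟨ c ⟩ ℕ.≟ 0
    ... | yes α≡0 | yes β≡0 = fzero , cong₂ (λ x y → multiples (divisor x y)) (sym α≡0) (sym β≡0)
    ... | no α≢0  | _       = as-vertex c (inj₁ (ℕ.n≢0⇒n>0 α≢0))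
    ... | yes _   | no β≢0  = as-vertex c (inj₂ (ℕ.n≢0⇒n>0 β≢0))
    d-typed : ∀ c → typeOf (multiples (d c)) ≡ X
    d-typed c = typeOf-multiples-X α⟨ c ⟩ β⟨ c ⟩ (toℕ≤pred[n] (proj₁ (exponents c))) (toℕ≤pred[n] (proj₂ (exponents c)))
    d-onto : ∀ i → typeOf (w i) ≡ X → ∃ λ c → w i ≡ multiples (d c)
    d-onto fzero    _         = combine {suc m₁′} {suc m₂′} fzero fzero , cong multiples (sym (d-combine (fzero {m₁′}) (fzero {m₂′})))
    d-onto (fsuc j) vⱼ-typed with n/p∈ , n/q∈ ← typeOf≡X⇒ (v-vertex j) vⱼ-typed =
      combine a b , trans I≡ (cong multiples (trans (cong₂ divisor (sym (toℕ-fromℕ< (s≤s α≤m₁′))) (sym (toℕ-fromℕ< (s≤s β≤m₂′))))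
                                                    (sym (d-combine a b))))
      where
      open DivisorForm (vertex⇒divisorForm (v-vertex j))
      α≤m₁′ : α ≤ m₁′
      α≤m₁′ = n/p∈multiples⇒ α β (subst (n/p ∈_) I≡ n/p∈)
      β≤m₂′ : β ≤ m₂′
      β≤m₂′ = n/q∈multiples⇒ α β (subst (n/q ∈_) I≡ n/q∈)
      a : Fin (suc m₁′)
      a = fromℕ< (s≤s α≤m₁′)
      b : Fin (suc m₂′)
      b = fromℕ< (s≤s β≤m₂′)

open import Defs
open import Data.Nat as ℕ using (ℕ; _<_; _≤_; _∸_)
open import Data.Nat.Primality using (Prime)
open import Data.Fin using (Fin)
open import Data.Fin.Subset using (Subset)
open import Data.Integer using (ℤ; +_; _+_; _*_)
open import Data.Product using (∃; _×_)
open import Data.Sum using (_⊎_)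
open import Function.Definitions using (Injective)
open import Relation.Nullary using (¬_)
open import Relation.Binary.PropositionalEquality using (_≡_; _≢_)

open Determinant using (det-cong; δ-refl; δ-≢)
open TypeMatrix using (Type; X; weight; typeMatrix; count; detFormula; det≡detFormula)
open CharPoly using (detFormula*[x+1]²; detFormula≡)
open import Data.Nat using (zero; suc)
import Data.Nat.Properties as ℕ
open import Data.Fin.Properties using (_≟_)
open import Data.Integer using (-_)
open import Data.Integer.Tactic.RingSolver using (solve-∀)
open import Data.Empty using (⊥-elim)
open import Data.Product using (_,_)
open import Data.Sum using (inj₁; inj₂)
open import Relation.Nullary using (yes; no)
open import Relation.Binary.PropositionalEquality using (refl; sym; trans; cong; cong₂)
open import Data.Nat.Primality using (prime⇒nonZero)

IsAdjacencyMatrix : ∀ {n N} → (Fin N → Subset n) → Matrix N → Set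
IsAdjacencyMatrix v A = ∀ i j →
  (A i j ≡ + 1 × i ≢ j × EssAdj (v i) (v j)) ⊎ (A i j ≡ + 0 × ¬ (i ≢ j × EssAdj (v i) (v j)))

module Spectrum (k p q m₁′ m₂′ : ℕ) (n≡ : suc k ≡ p ℕ.^ suc m₁′ ℕ.* q ℕ.^ suc m₂′)
                (p-prime : Prime p) (q-prime : Prime q) (p≢q : p ≢ q)
                (N : ℕ) (v : Fin N → Subset (suc k)) (v-injective : Injective _≡_ _≡_ v)
                (v-vertex : ∀ i → IsVertex (v i)) (v-onto : ∀ I → IsVertex I → ∃ λ i → v i ≡ I)
                (A : Matrix N) (A-adjacency : IsAdjacencyMatrix v A) where

  open Graph k p q m₁′ m₂′ n≡ p-prime q-prime p≢q using (typeOf; weight-typeOf)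
  open VertexCount k p q m₁′ m₂′ n≡ p-prime q-prime p≢q N v v-injective v-vertex v-onto using (count-X; count-Y; count-Z)

  t : Fin N → Type
  t i = typeOf (v i)

  A-diagonal : ∀ i → A i i ≡ + 0
  A-diagonal i with A-adjacency i i
  ... | inj₁ (_ , i≢i , _) = ⊥-elim (i≢i refl)
  ... | inj₂ (Aᵢᵢ≡0 , _)   = Aᵢᵢ≡0

  A-offDiagonal : ∀ i j → i ≢ j → A i j ≡ weight (t i) (t j)
  A-offDiagonal i j i≢j with A-adjacency i j | weight-typeOf (v-vertex i) (v-vertex j)
  ... | inj₁ (Aᵢⱼ≡1 , _ , _)   | inj₁ (w≡1 , _)           = trans Aᵢⱼ≡1 (sym w≡1)
  ... | inj₁ (_ , _ , adjacent) | inj₂ (_ , ¬adjacent)    = ⊥-elim (¬adjacent adjacent)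
  ... | inj₂ (_ , ¬adjacent)    | inj₁ (_ , adjacent)      = ⊥-elim (¬adjacent (i≢j , adjacent))
  ... | inj₂ (Aᵢⱼ≡0 , _)        | inj₂ (w≡0 , _)           = trans Aᵢⱼ≡0 (sym w≡0)

  charMatrix≡typeMatrix : ∀ x i j → x * δ i j + - A i j ≡ typeMatrix x t i j
  charMatrix≡typeMatrix x i j with i ≟ j
  ... | yes refl rewrite δ-refl i | A-diagonal i = diagonal x (weight (t i) (t i))
    where
    diagonal : ∀ x w → x * + 1 + - + 0 ≡ (x + w) * + 1 + - w
    diagonal = solve-∀
  ... | no i≢j rewrite δ-≢ i j i≢j | A-offDiagonal i j i≢j = off-diagonal x (x + weight (t i) (t i)) (weight (t i) (t j))
    where
    off-diagonal : ∀ x y w → x * + 0 + - w ≡ y * + 0 + - w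
    off-diagonal = solve-∀

  charPolyAt≡detFormula : ∀ x → charPolyAt A x ≡ detFormula x (count t X) (suc m₂′) (suc m₁′)
  charPolyAt≡detFormula x =
    trans (det-cong (charMatrix≡typeMatrix x))
    (trans (det≡detFormula N x t) (cong₂ (detFormula x (count t X)) count-Y count-Z))

  charPolyAt*[x+1]² : ∀ x → charPolyAt A x * (x + + 1) ^ᶻ 2
    ≡ x ^ᶻ (suc m₁′ ℕ.+ suc m₂′ ∸ 2) * (x + + 1) ^ᶻ (suc m₁′ ℕ.* suc m₂′) * Pcub (suc m₁′) (suc m₂′) x
  charPolyAt*[x+1]² x =
    trans (cong (_* (x + + 1) ^ᶻ 2) (charPolyAt≡detFormula x)) (detFormula*[x+1]² x (count t X) m₂′ m₁′ count-X)

  -- If m₁ m₂ ≥ 2 there is a vertex of type X, so the factor (x + 1) ^ 2 can be cancelled.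
  charPolyAt≡ : 2 ≤ suc m₁′ ℕ.* suc m₂′ → ∀ x →
    charPolyAt A x ≡ x ^ᶻ (suc m₁′ ℕ.+ suc m₂′ ∸ 2) * (x + + 1) ^ᶻ (suc m₁′ ℕ.* suc m₂′ ∸ 2) * Pcub (suc m₁′) (suc m₂′) x
  charPolyAt≡ 2≤m₁m₂ x = trans (charPolyAt≡detFormula x) (by-count (count t X) refl)
    where
    by-count : ∀ a → a ≡ count t X →
      detFormula x a (suc m₂′) (suc m₁′) ≡ x ^ᶻ (suc m₁′ ℕ.+ suc m₂′ ∸ 2) * (x + + 1) ^ᶻ (suc m₁′ ℕ.* suc m₂′ ∸ 2) * Pcub (suc m₁′) (suc m₂′) x
    by-count zero    0≡a with () ← ℕ.<-irrefl (trans (cong suc 0≡a) count-X) 2≤m₁m₂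
    by-count (suc a) a≡  = detFormula≡ x a m₂′ m₁′ (trans (cong suc a≡) count-X)

-- The conclusion of the theorem for the modulus n, stated separately so that n can be matched as suc k.
CharPolyClaim : (m₁ m₂ n : ℕ) → Set
CharPolyClaim m₁ m₂ n =
  (N : ℕ) (v : Fin N → Subset n) → Injective _≡_ _≡_ v → (∀ i → IsVertex (v i)) →
  (∀ I → IsVertex I → ∃ λ i → v i ≡ I) → (A : Matrix N) → IsAdjacencyMatrix v A →
  (∀ (x : ℤ) → charPolyAt A x * (x + + 1) ^ᶻ 2 ≡ x ^ᶻ (m₁ ℕ.+ m₂ ∸ 2) * (x + + 1) ^ᶻ (m₁ ℕ.* m₂) * Pcub m₁ m₂ x)
  × (2 ≤ m₁ ℕ.* m₂ → ∀ (x : ℤ) → charPolyAt A x ≡ x ^ᶻ (m₁ ℕ.+ m₂ ∸ 2) * (x + + 1) ^ᶻ (m₁ ℕ.* m₂ ∸ 2) * Pcub m₁ m₂ x)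

charPolyClaim : ∀ k p q m₁′ m₂′ → suc k ≡ p ℕ.^ suc m₁′ ℕ.* q ℕ.^ suc m₂′ → Prime p → Prime q → p ≢ q →
  CharPolyClaim (suc m₁′) (suc m₂′) (suc k)
charPolyClaim k p q m₁′ m₂′ n≡ p-prime q-prime p≢q N v v-injective v-vertex v-onto A A-adjacency =
  charPolyAt*[x+1]² , charPolyAt≡
  where open Spectrum k p q m₁′ m₂′ n≡ p-prime q-prime p≢q N v v-injective v-vertex v-onto A A-adjacency

mainTheorem4 : (p q m₁ m₂ : ℕ) → Prime p → Prime q → p < q → 1 ≤ m₁ → 1 ≤ m₂ →
    let n = p ℕ.^ m₁ ℕ.* q ℕ.^ m₂ in
    (N : ℕ) (v : Fin N → Subset n) →
    Injective _≡_ _≡_ v →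
    (∀ i → IsVertex (v i)) →
    (∀ I → IsVertex I → ∃ λ i → v i ≡ I) →
    (A : Matrix N) →
    (∀ i j → (A i j ≡ + 1 × i ≢ j × EssAdj (v i) (v j)) ⊎ (A i j ≡ + 0 × ¬ (i ≢ j × EssAdj (v i) (v j)))) →
    (∀ (x : ℤ) → charPolyAt A x * (x + + 1) ^ᶻ 2
                   ≡ x ^ᶻ (m₁ ℕ.+ m₂ ∸ 2) * (x + + 1) ^ᶻ (m₁ ℕ.* m₂) * Pcub m₁ m₂ x)
    × (2 ≤ m₁ ℕ.* m₂ → ∀ (x : ℤ) → charPolyAt A x
                   ≡ x ^ᶻ (m₁ ℕ.+ m₂ ∸ 2) * (x + + 1) ^ᶻ (m₁ ℕ.* m₂ ∸ 2) * Pcub m₁ m₂ x)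
mainTheorem4 p q (suc m₁′) (suc m₂′) p-prime q-prime p<q _ _ = claim (p ℕ.^ suc m₁′ ℕ.* q ℕ.^ suc m₂′) refl
  where
  claim : ∀ n → n ≡ p ℕ.^ suc m₁′ ℕ.* q ℕ.^ suc m₂′ → CharPolyClaim (suc m₁′) (suc m₂′) n
  claim zero 0≡n = ⊥-elim (ℕ.≢-nonZero⁻¹ _ {{n≢0}} (sym 0≡n))
    where
    instance _ = prime⇒nonZero p-prime
    instance _ = prime⇒nonZero q-prime
    n≢0 : ℕ.NonZero (p ℕ.^ suc m₁′ ℕ.* q ℕ.^ suc m₂′)
    n≢0 = ℕ.m*n≢0 _ _ {{ℕ.m^n≢0 p (suc m₁′)}} {{ℕ.m^n≢0 q (suc m₂′)}}
  claim (suc k) n≡ = charPolyClaim k p q m₁′ m₂′ n≡ p-prime q-prime (ℕ.<⇒≢ p<q)
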